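{- Let $n\ge2$, $1\le m<n$, and $A,A'\in SL(n,\mathbb{Z})$. Then there exists $X\in\widetilde P_{n,m}(\mathbb{Z})$ with $A=XA'$ if and only if, for each $1\le k\le m$, the matrices $A$ and $A'$ have the same $k\times k$ minors in their bottom $k$ rows.
   Context: $\widetilde P_{n,m}(\mathbb{Z})$ is the subgroup of $SL(n,\mathbb{Z})$ of matrices of block form $\begin{pmatrix}a&b\\0&u\end{pmatrix}$ where $a\in SL(n-m,\mathbb{Z})$ is the upper-left $(n-m)\times(n-m)$ block, $b$ is an arbitrary integer $(n-m)\times m$ block, the lower-left $m\times(n-m)$ block is zero, and $u$ is an $m\times m$ upper triangular integer matrix with all diagonal entries $1$. "The $k\times k$ minors in the bottom $k$ rows" means the determinants of all $k\times k$ submatrices formed from the last $k$ rows and any $k$ columns. -}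

module Defs where

open import Data.Nat as ℕ using (ℕ; zero; suc)
import Data.Nat.Properties as ℕP
import Data.Fin.Properties as FinP
open import Data.Fin as Fin using (Fin; zero; suc; toℕ; fromℕ<; punchIn)
open import Data.Integer using (ℤ; _+_; _*_; -_; 0ℤ; 1ℤ)
open import Data.Product using (Σ; _×_; _,_)
open import Relation.Binary.PropositionalEquality using (_≡_)

-- Square integer matrices of size n, entry (i , j) = row i, column j.
Matrix : ℕ → Set
Matrix n = Fin n → Fin n → ℤ

∑ : ∀ {n} → (Fin n → ℤ) → ℤ
∑ {zero}  f = 0ℤ
∑ {suc n} f = f zero + ∑ (λ i → f (suc i))

_⊗_ : ∀ {n} → Matrix n → Matrix n → Matrix n
(A ⊗ B) i j = ∑ (λ l → A i l * B l j)

sgn : ℕ → ℤ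
sgn zero          = 1ℤ
sgn (suc zero)    = - 1ℤ
sgn (suc (suc k)) = sgn k

det : ∀ {n} → Matrix n → ℤ
det {zero}  A = 1ℤ
det {suc n} A =
  ∑ (λ j → sgn (toℕ j) * (A zero j * det (λ r c → A (suc r) (punchIn j c))))

IsSL : ∀ {n} → Matrix n → Set
IsSL A = det A ≡ 1ℤ

topIndex : ∀ {n p} → p ℕ.≤ n → Fin p → Fin n
topIndex {n} {p} p≤n i = fromℕ< {toℕ i} (ℕP.<-≤-trans (FinP.toℕ<n i) p≤n)

-- The subgroup P̃_{n,m}(ℤ) of SL(n,ℤ) (for m ≤ n): block form (a b; 0 u)
-- where the upper-left (n-m)×(n-m) block a has det 1, the lower-left
-- m × (n-m) block is zero, and the lower-right m × m block u is upper
-- unitriangular.  Index i lies in the bottom m rows iff n - m ≤ toℕ i.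
InPtilde : (n m : ℕ) → m ℕ.≤ n → Matrix n → Set
InPtilde n m m≤n X =
  det (λ r s → X (topIndex (ℕP.m∸n≤m n m) r) (topIndex (ℕP.m∸n≤m n m) s)) ≡ 1ℤ
  × (∀ (i j : Fin n) → n ℕ.∸ m ℕ.≤ toℕ i →
       (toℕ j ℕ.< toℕ i → X i j ≡ 0ℤ)
       × (toℕ j ≡ toℕ i → X i j ≡ 1ℤ))

-- A choice of k columns: strictly increasing map Fin k → Fin n.
StrictlyIncreasing : ∀ {k n} → (Fin k → Fin n) → Set
StrictlyIncreasing {k} c = ∀ (i j : Fin k) → toℕ i ℕ.< toℕ j → toℕ (c i) ℕ.< toℕ (c j)

bottomRow : ∀ {n k} → k ℕ.≤ n → Fin k → Fin n
bottomRow {n} {k} k≤n i = fromℕ< {n ℕ.∸ k ℕ.+ toℕ i} lt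
  where
  lt : n ℕ.∸ k ℕ.+ toℕ i ℕ.< n
  lt = ℕP.≤-trans (ℕP.+-monoʳ-< (n ℕ.∸ k) (FinP.toℕ<n i))
                  (ℕP.≤-reflexive (ℕP.m∸n+n≡m k≤n))

bottomMinor : ∀ {n k} → k ℕ.≤ n → Matrix n → (Fin k → Fin n) → ℤ
bottomMinor k≤n A c = det (λ r s → A (bottomRow k≤n r) (c s))

{-# OPTIONS --safe #-}
-- If A = X A′ with X ∈ P̃, then for k ≤ m the bottom k rows of A are the bottom-right k × k block
-- of X, which is unitriangular, times the bottom k rows of A′; so the bottom k × k minors agree.
-- Conversely X := A A′⁻¹ is given by Cramer's rule: X r l = det (A′ with row l replaced by A r).
-- A determinant is determined by its top rows together with the minors of its bottom k rows, so,
-- working upwards from the last row, equality of the bottom minors forces X r r = 1 and X r l = 0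
-- for l < r in each of the bottom m rows; then det X = 1 gives the top-left block determinant 1.
-- The determinant is Laplace expansion along the first row: alternation comes from expanding along
-- two rows at once, and multiplicativity and Cramer's rule from the fact that an alternating
-- multilinear form D satisfies D M = det M · D I.
module Submission where

open import Algebra.Bundles using (AbelianGroup)
open import Algebra.Properties.CommutativeSemigroup using (interchange)
open import Data.Empty using (⊥-elim)
open import Data.Fin as Fin using (Fin; zero; suc; toℕ; punchIn; punchOut; inject₁; fromℕ<; _≟_)
import Data.Fin.Properties as FinP
open import Data.Integer as ℤ using (ℤ; 0ℤ; 1ℤ; -_; _+_; _*_)
import Data.Integer.Properties as ℤP
open import Data.Integer.Tactic.RingSolver using (solve-∀)
open import Data.Nat as ℕ using (ℕ; _≤_; _<_; _∸_; z≤n; s≤s)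
open import Data.Nat.Properties using (<⇒≤)
import Data.Nat.Properties as ℕP
open import Data.Product using (Σ; _×_; _,_; proj₁; proj₂)
open import Data.List using (List; []; _∷_; allFin)
open import Data.List.Membership.Propositional using (_∈_)
open import Data.List.Membership.Propositional.Properties using (∈-allFin)
open import Data.List.Relation.Unary.Any using (here; there)
open import Data.Vec.Functional using (updateAt) renaming (_∷_ to _∷ᵛ_)
open import Data.Vec.Functional.Properties using (updateAt-updates; updateAt-minimal; updateAt-id-local; updateAt-updateAt; updateAt-commutes)
open import Function.Base using (_∘_; case_of_)
open import Function.Bundles using (_⇔_; mk⇔)
open import Relation.Binary.PropositionalEquality
  using (_≡_; _≢_; refl; sym; trans; cong; cong₂; cong-app; subst; subst₂; module ≡-Reasoning)
open import Relation.Nullary using (Dec; yes; no; ¬_)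

open import Algebra.Properties.Group (AbelianGroup.group ℤP.+-0-abelianGroup) using (inverseʳ-unique)

open import Defs

-- Finite sums, rows and the Kronecker delta

by-cases : ∀ {A P : Set} → Dec A → (A → P) → (¬ A → P) → P
by-cases (yes a) f g = f a
by-cases (no ¬a) f g = g ¬a

∑-cong : ∀ {n} {f g : Fin n → ℤ} → (∀ i → f i ≡ g i) → ∑ f ≡ ∑ g
∑-cong {ℕ.zero}  f≗g = refl
∑-cong {ℕ.suc n} f≗g = cong₂ _+_ (f≗g zero) (∑-cong (λ i → f≗g (suc i)))

∑-zero : ∀ {n} (f : Fin n → ℤ) → (∀ i → f i ≡ 0ℤ) → ∑ f ≡ 0ℤ
∑-zero {ℕ.zero}  f f≗0 = refl
∑-zero {ℕ.suc n} f f≗0 = cong₂ _+_ (f≗0 zero) (∑-zero (λ i → f (suc i)) (λ i → f≗0 (suc i)))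

∑-distrib-+ : ∀ {n} (f g : Fin n → ℤ) → ∑ (λ i → f i + g i) ≡ ∑ f + ∑ g
∑-distrib-+ {ℕ.zero}  f g = refl
∑-distrib-+ {ℕ.suc n} f g =
  trans (cong (f zero + g zero +_) (∑-distrib-+ (λ i → f (suc i)) (λ i → g (suc i))))
        (interchange ℤP.+-commutativeSemigroup (f zero) (g zero) _ _)

∑-distribˡ-* : ∀ {n} (c : ℤ) (f : Fin n → ℤ) → ∑ (λ i → c * f i) ≡ c * ∑ f
∑-distribˡ-* {ℕ.zero}  c f = sym (ℤP.*-zeroʳ c)
∑-distribˡ-* {ℕ.suc n} c f =
  trans (cong (c * f zero +_) (∑-distribˡ-* c (λ i → f (suc i)))) (sym (ℤP.*-distribˡ-+ c _ _))

∑-distribʳ-* : ∀ {n} (f : Fin n → ℤ) (c : ℤ) → ∑ (λ i → f i * c) ≡ ∑ f * c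
∑-distribʳ-* f c =
  trans (∑-cong (λ i → ℤP.*-comm (f i) c)) (trans (∑-distribˡ-* c f) (ℤP.*-comm c (∑ f)))

∑-neg : ∀ {n} (f : Fin n → ℤ) → ∑ (λ i → - f i) ≡ - ∑ f
∑-neg {ℕ.zero}  f = refl
∑-neg {ℕ.suc n} f =
  trans (cong (- f zero +_) (∑-neg (λ i → f (suc i)))) (sym (ℤP.neg-distrib-+ (f zero) _))

∑-single : ∀ {n} (f : Fin n → ℤ) (a : Fin n) → (∀ i → i ≢ a → f i ≡ 0ℤ) → ∑ f ≡ f a
∑-single f zero    f≗0 =
  trans (cong (f zero +_) (∑-zero _ (λ i → f≗0 (suc i) (λ ())))) (ℤP.+-identityʳ _)
∑-single f (suc a) f≗0 =
  trans (cong₂ _+_ (f≗0 zero (λ ())) (∑-single (λ i → f (suc i)) a (λ i i≢a → f≗0 (suc i) (λ p → i≢a (FinP.suc-injective p)))))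
        (ℤP.+-identityˡ _)

∑-pair : ∀ {n} (f : Fin n → ℤ) {a b : Fin n} → a ≢ b → (∀ i → i ≢ a → i ≢ b → f i ≡ 0ℤ) → ∑ f ≡ f a + f b
∑-pair f {zero}  {zero}  a≢b f≗0 = ⊥-elim (a≢b refl)
∑-pair f {zero}  {suc b} a≢b f≗0 =
  cong (f zero +_) (∑-single _ b (λ i i≢b → f≗0 (suc i) (λ ()) (λ p → i≢b (FinP.suc-injective p))))
∑-pair f {suc a} {zero}  a≢b f≗0 =
  trans (cong (f zero +_) (∑-single _ a (λ i i≢a → f≗0 (suc i) (λ p → i≢a (FinP.suc-injective p)) (λ ()))))
        (ℤP.+-comm (f zero) _)
∑-pair f {suc a} {suc b} a≢b f≗0 =
  trans (cong₂ _+_ (f≗0 zero (λ ()) (λ ()))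
                   (∑-pair (λ i → f (suc i)) (λ p → a≢b (cong suc p))
                      (λ i i≢a i≢b → f≗0 (suc i) (λ p → i≢a (FinP.suc-injective p)) (λ p → i≢b (FinP.suc-injective p)))))
        (ℤP.+-identityˡ _)

δ : ∀ {n} → Fin n → Fin n → ℤ
δ i j with i ≟ j
... | yes _ = 1ℤ
... | no  _ = 0ℤ

δ-≡ : ∀ {n} {i j : Fin n} → i ≡ j → δ i j ≡ 1ℤ
δ-≡ {i = i} {j} i≡j with i ≟ j
... | yes _   = refl
... | no  i≢j = ⊥-elim (i≢j i≡j)

δ-≢ : ∀ {n} {i j : Fin n} → i ≢ j → δ i j ≡ 0ℤ
δ-≢ {i = i} {j} i≢j with i ≟ j
... | yes i≡j = ⊥-elim (i≢j i≡j)
... | no  _   = refl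

∑-*-δ : ∀ {n} (v : Fin n → ℤ) (c : Fin n) → ∑ (λ j → v j * δ j c) ≡ v c
∑-*-δ v c =
  trans (∑-single _ c (λ j j≢c → trans (cong (v j *_) (δ-≢ j≢c)) (ℤP.*-zeroʳ (v j))))
        (trans (cong (v c *_) (δ-≡ {i = c} refl)) (ℤP.*-identityʳ (v c)))

∑-δ-* : ∀ {n} (v : Fin n → ℤ) (c : Fin n) → ∑ (λ j → δ c j * v j) ≡ v c
∑-δ-* v c =
  trans (∑-single _ c (λ j j≢c → cong (_* v j) (δ-≢ (λ c≡j → j≢c (sym c≡j)))))
        (trans (cong (_* v c) (δ-≡ {i = c} refl)) (ℤP.*-identityˡ (v c)))

I : ∀ {n} → Matrix n
I = δ

infix 4 _≋_
_≋_ : ∀ {n} → Matrix n → Matrix n → Set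
M ≋ N = ∀ i j → M i j ≡ N i j

setRow : ∀ {n} → Matrix n → Fin n → (Fin n → ℤ) → Matrix n
setRow M i v = updateAt M i (λ _ → v)

module _ {n : ℕ} (M : Matrix n) (i : Fin n) (v : Fin n → ℤ) where

  setRow-≡ : ∀ {r} → r ≡ i → ∀ c → setRow M i v r c ≡ v c
  setRow-≡ refl = cong-app (updateAt-updates i M)

  setRow-≢ : ∀ {r} → r ≢ i → ∀ c → setRow M i v r c ≡ M r c
  setRow-≢ {r} r≢i = cong-app (updateAt-minimal r i M r≢i)

setRow-self : ∀ {n} (M : Matrix n) i → setRow M i (M i) ≋ M
setRow-self M i r = cong-app (updateAt-id-local i M refl r)

setRow-cong : ∀ {n} {M N : Matrix n} i {u v : Fin n → ℤ} → M ≋ N → (∀ c → u c ≡ v c) → setRow M i u ≋ setRow N i v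
setRow-cong {M = M} {N} i {u} {v} M≋N u≗v r c = by-cases (r ≟ i)
  (λ r≡i → trans (setRow-≡ M i u r≡i c) (trans (u≗v c) (sym (setRow-≡ N i v r≡i c))))
  (λ r≢i → trans (setRow-≢ M i u r≢i c) (trans (M≋N r c) (sym (setRow-≢ N i v r≢i c))))

setRow-comm : ∀ {n} (M : Matrix n) {i j} u v → i ≢ j → setRow (setRow M i u) j v ≋ setRow (setRow M j v) i u
setRow-comm M {i} {j} u v i≢j r = cong-app (updateAt-commutes j i (λ j≡i → i≢j (sym j≡i)) M r)

setRow-setRow : ∀ {n} (M : Matrix n) i u v → setRow (setRow M i u) i v ≋ setRow M i v
setRow-setRow M i u v r = cong-app (updateAt-updateAt i M r)

swapRows : ∀ {n} → Matrix n → Fin n → Fin n → Matrix n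
swapRows M a b = setRow (setRow M a (M b)) b (M a)

-- Multilinearity and alternation of the determinant

minor : ∀ {n} → Matrix (ℕ.suc n) → Fin (ℕ.suc n) → Matrix n
minor M j r c = M (suc r) (punchIn j c)

det-cong : ∀ {n} {M N : Matrix n} → M ≋ N → det M ≡ det N
det-cong {ℕ.zero}  M≋N = refl
det-cong {ℕ.suc n} M≋N = ∑-cong (λ j → cong (sgn (toℕ j) *_)
  (cong₂ _*_ (M≋N zero j) (det-cong (λ r c → M≋N (suc r) (punchIn j c)))))

sgn-suc : ∀ k → sgn (ℕ.suc k) ≡ - sgn k
sgn-suc ℕ.zero    = refl
sgn-suc (ℕ.suc k) = trans (sym (ℤP.neg-involutive (sgn k))) (cong -_ (sym (sgn-suc k)))

laplace : ∀ {n} → (Fin n → ℤ) → (Fin n → ℤ) → ℤ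
laplace a b = ∑ (λ j → sgn (toℕ j) * (a j * b j))

module _ {n : ℕ} where

  laplace-cong : {a a′ b b′ : Fin n → ℤ} → (∀ j → a j ≡ a′ j) → (∀ j → b j ≡ b′ j) → laplace a b ≡ laplace a′ b′
  laplace-cong a≗a′ b≗b′ = ∑-cong (λ j → cong (sgn (toℕ j) *_) (cong₂ _*_ (a≗a′ j) (b≗b′ j)))

  laplace-congʳ : ∀ a {b b′ : Fin n → ℤ} → (∀ j → b j ≡ b′ j) → laplace a b ≡ laplace a b′
  laplace-congʳ a = laplace-cong {a = a} (λ _ → refl)

  laplace-+ˡ : ∀ (a a′ b : Fin n → ℤ) → laplace (λ j → a j + a′ j) b ≡ laplace a b + laplace a′ b
  laplace-+ˡ a a′ b =
    trans (∑-cong (λ j → distrib (sgn (toℕ j)) (a j) (a′ j) (b j)))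
          (∑-distrib-+ (λ j → sgn (toℕ j) * (a j * b j)) (λ j → sgn (toℕ j) * (a′ j * b j)))
    where
    distrib : ∀ s x y z → s * ((x + y) * z) ≡ s * (x * z) + s * (y * z)
    distrib = solve-∀

  laplace-+ʳ : ∀ (a b b′ : Fin n → ℤ) → laplace a (λ j → b j + b′ j) ≡ laplace a b + laplace a b′
  laplace-+ʳ a b b′ =
    trans (∑-cong (λ j → distrib (sgn (toℕ j)) (a j) (b j) (b′ j)))
          (∑-distrib-+ (λ j → sgn (toℕ j) * (a j * b j)) (λ j → sgn (toℕ j) * (a j * b′ j)))
    where
    distrib : ∀ s x y z → s * (x * (y + z)) ≡ s * (x * y) + s * (x * z)
    distrib = solve-∀

  laplace-*ˡ : ∀ t (a b : Fin n → ℤ) → laplace (λ j → t * a j) b ≡ t * laplace a b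
  laplace-*ˡ t a b =
    trans (∑-cong (λ j → pull (sgn (toℕ j)) t (a j) (b j))) (∑-distribˡ-* t (λ j → sgn (toℕ j) * (a j * b j)))
    where
    pull : ∀ s t x y → s * ((t * x) * y) ≡ t * (s * (x * y))
    pull = solve-∀

  laplace-*ʳ : ∀ t (a b : Fin n → ℤ) → laplace a (λ j → t * b j) ≡ t * laplace a b
  laplace-*ʳ t a b =
    trans (∑-cong (λ j → pull (sgn (toℕ j)) t (a j) (b j))) (∑-distribˡ-* t (λ j → sgn (toℕ j) * (a j * b j)))
    where
    pull : ∀ s t x y → s * (x * (t * y)) ≡ t * (s * (x * y))
    pull = solve-∀

  laplace-negʳ : ∀ (a b : Fin n → ℤ) → laplace a (λ j → - b j) ≡ - laplace a b
  laplace-negʳ a b =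
    trans (∑-cong (λ j → pull (sgn (toℕ j)) (a j) (b j))) (∑-neg (λ j → sgn (toℕ j) * (a j * b j)))
    where
    pull : ∀ s x y → s * (x * - y) ≡ - (s * (x * y))
    pull = solve-∀

  laplace-zeroʳ : ∀ (a b : Fin n → ℤ) → (∀ j → b j ≡ 0ℤ) → laplace a b ≡ 0ℤ
  laplace-zeroʳ a b b≗0 = ∑-zero _ (λ j →
    trans (cong (λ x → sgn (toℕ j) * (a j * x)) (b≗0 j))
          (trans (cong (sgn (toℕ j) *_) (ℤP.*-zeroʳ (a j))) (ℤP.*-zeroʳ (sgn (toℕ j)))))

laplace-suc : ∀ {n} (a b : Fin (ℕ.suc n) → ℤ) →
  laplace a b ≡ a zero * b zero + - laplace (λ j → a (suc j)) (λ j → b (suc j))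
laplace-suc a b = cong₂ _+_ (ℤP.*-identityˡ (a zero * b zero))
  (trans (∑-cong (λ j → trans (cong (_* ab (suc j)) (sgn-suc (toℕ j))) (sym (ℤP.neg-distribˡ-* (sgn (toℕ j)) (ab (suc j))))))
         (∑-neg (λ j → sgn (toℕ j) * ab (suc j))))
  where
  ab = λ j → a j * b j

det-setRow₀ : ∀ {n} (M : Matrix (ℕ.suc n)) v → det (setRow M zero v) ≡ laplace v (λ j → det (minor M j))
det-setRow₀ M v = laplace-cong {b = λ j → det (minor (setRow M zero v) j)} (setRow-≡ M zero v refl)
  (λ j → det-cong (λ r c → setRow-≢ M zero v {suc r} (λ ()) (punchIn j c)))

minor-setRowₛ : ∀ {n} (M : Matrix (ℕ.suc n)) i v j →
  minor (setRow M (suc i) v) j ≋ setRow (minor M j) i (λ c → v (punchIn j c))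
minor-setRowₛ M i v j r c = by-cases (r ≟ i)
  (λ r≡i → trans (setRow-≡ M (suc i) v (cong suc r≡i) _) (sym (setRow-≡ (minor M j) i _ r≡i c)))
  (λ r≢i → trans (setRow-≢ M (suc i) v (λ p → r≢i (FinP.suc-injective p)) _) (sym (setRow-≢ (minor M j) i _ r≢i c)))

det-setRowₛ : ∀ {n} (M : Matrix (ℕ.suc n)) i v →
  det (setRow M (suc i) v) ≡ laplace (M zero) (λ j → det (setRow (minor M j) i (λ c → v (punchIn j c))))
det-setRowₛ M i v = laplace-cong {b = λ j → det (minor (setRow M (suc i) v) j)}
  (setRow-≢ M (suc i) v (λ ())) (λ j → det-cong (minor-setRowₛ M i v j))

det-setRow-+ : ∀ {n} (M : Matrix n) i (u v : Fin n → ℤ) →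
  det (setRow M i (λ c → u c + v c)) ≡ det (setRow M i u) + det (setRow M i v)
det-setRow-+ {ℕ.suc n} M zero u v = begin
  det (setRow M zero (λ c → u c + v c))               ≡⟨ det-setRow₀ M (λ c → u c + v c) ⟩
  laplace (λ c → u c + v c) (λ j → det (minor M j))   ≡⟨ laplace-+ˡ u v (λ j → det (minor M j)) ⟩
  laplace u (λ j → det (minor M j)) + laplace v (λ j → det (minor M j))
                                                      ≡⟨ sym (cong₂ _+_ (det-setRow₀ M u) (det-setRow₀ M v)) ⟩
  det (setRow M zero u) + det (setRow M zero v)       ∎
  where open ≡-Reasoning
det-setRow-+ {ℕ.suc n} M (suc i) u v = begin
  det (setRow M (suc i) (λ c → u c + v c))          ≡⟨ det-setRowₛ M i _ ⟩
  laplace (M zero) (D (λ c → u c + v c))            ≡⟨ laplace-congʳ (M zero) (λ j → det-setRow-+ (minor M j) i (u ∘ punchIn j) (v ∘ punchIn j)) ⟩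
  laplace (M zero) (λ j → D u j + D v j)            ≡⟨ laplace-+ʳ (M zero) (D u) (D v) ⟩
  laplace (M zero) (D u) + laplace (M zero) (D v)   ≡⟨ sym (cong₂ _+_ (det-setRowₛ M i u) (det-setRowₛ M i v)) ⟩
  det (setRow M (suc i) u) + det (setRow M (suc i) v) ∎
  where
  open ≡-Reasoning
  D : (Fin (ℕ.suc n) → ℤ) → Fin (ℕ.suc n) → ℤ
  D w j = det (setRow (minor M j) i (w ∘ punchIn j))

det-setRow-* : ∀ {n} (M : Matrix n) i t (u : Fin n → ℤ) →
  det (setRow M i (λ c → t * u c)) ≡ t * det (setRow M i u)
det-setRow-* {ℕ.suc n} M zero t u =
  trans (det-setRow₀ M (λ c → t * u c)) (trans (laplace-*ˡ t u (λ j → det (minor M j))) (cong (t *_) (sym (det-setRow₀ M u))))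
det-setRow-* {ℕ.suc n} M (suc i) t u = begin
  det (setRow M (suc i) (λ c → t * u c))   ≡⟨ det-setRowₛ M i _ ⟩
  laplace (M zero) (D (λ c → t * u c))     ≡⟨ laplace-congʳ (M zero) (λ j → det-setRow-* (minor M j) i t (u ∘ punchIn j)) ⟩
  laplace (M zero) (λ j → t * D u j)       ≡⟨ laplace-*ʳ t (M zero) (D u) ⟩
  t * laplace (M zero) (D u)               ≡⟨ cong (t *_) (sym (det-setRowₛ M i u)) ⟩
  t * det (setRow M (suc i) u)             ∎
  where
  open ≡-Reasoning
  D : (Fin (ℕ.suc n) → ℤ) → Fin (ℕ.suc n) → ℤ
  D w j = det (setRow (minor M j) i (w ∘ punchIn j))

-- Expanding a determinant along two rows a, b whose entries are read through
-- a column selection f, the rows below being summarised by G.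
module DoubleExpansion {X : Set} where

  Congruent : ∀ {k} → ((Fin k → X) → ℤ) → Set
  Congruent G = ∀ {g h} → (∀ c → g c ≡ h c) → G g ≡ G h

  expand₁ : ∀ {k} → (X → ℤ) → (Fin (ℕ.suc k) → X) → ((Fin k → X) → ℤ) → ℤ
  expand₁ b g G = laplace (λ q → b (g q)) (λ q → G (λ c → g (punchIn q c)))

  expand₂ : ∀ {k} → (X → ℤ) → (X → ℤ) → (Fin (ℕ.suc (ℕ.suc k)) → X) → ((Fin k → X) → ℤ) → ℤ
  expand₂ a b f G = laplace (λ p → a (f p)) (λ p → expand₁ b (λ c → f (punchIn p c)) G)

  expand₂-congᴳ : ∀ {k} a b f {G G′ : (Fin k → X) → ℤ} → (∀ h → G h ≡ G′ h) → expand₂ a b f G ≡ expand₂ a b f G′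
  expand₂-congᴳ a b f G≗G′ = laplace-congʳ (λ p → a (f p)) (λ p →
    laplace-congʳ (λ q → b (f (punchIn p q))) (λ q → G≗G′ (λ c → f (punchIn p (punchIn q c)))))

  expand₂-two : ∀ a b (f : Fin 2 → X) g →
    expand₂ a b f (λ _ → g) ≡ (a (f zero) * b (f (suc zero)) + - (a (f (suc zero)) * b (f zero))) * g
  expand₂-two a b f g = det₂ (a (f zero)) (a (f (suc zero))) (b (f zero)) (b (f (suc zero))) g
    where
    det₂ : ∀ a₀ a₁ b₀ b₁ g →
      1ℤ * (a₀ * (1ℤ * (b₁ * g) + 0ℤ)) + (- 1ℤ * (a₁ * (1ℤ * (b₀ * g) + 0ℤ)) + 0ℤ) ≡ (a₀ * b₁ + - (a₁ * b₀)) * g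
    det₂ = solve-∀

  expand₁-punchIn-suc : ∀ {k} b (f : Fin (3 ℕ.+ k) → X) {G} → Congruent G → ∀ p →
    expand₁ b (λ c → f (punchIn (suc p) c)) G
      ≡ b (f zero) * G (λ c → f (suc (punchIn p c))) + - expand₁ b (λ c → f (suc (punchIn p c))) (λ h → G (f zero ∷ᵛ h))
  expand₁-punchIn-suc b f {G} G-cong p =
    trans (laplace-suc (λ q → b (f (punchIn (suc p) q))) (λ q → G (λ c → f (punchIn (suc p) (punchIn q c)))))
          (cong (λ x → b (f zero) * G (λ c → f (suc (punchIn p c))) + - x)
                (laplace-congʳ (λ q → b (f (suc (punchIn p q)))) columns≗))
    where
    columns≗ : ∀ q → G (λ c → f (punchIn (suc p) (punchIn (suc q) c)))
                    ≡ G (f zero ∷ᵛ (λ c → f (suc (punchIn p (punchIn q c)))))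
    columns≗ q = G-cong (λ { zero → refl ; (suc c) → refl })

  expand₂-suc : ∀ {k} a b (f : Fin (3 ℕ.+ k) → X) {G} → Congruent G →
    expand₂ a b f G ≡ a (f zero) * expand₁ b (λ c → f (suc c)) G + - (b (f zero) * expand₁ a (λ c → f (suc c)) G)
                      + expand₂ a b (λ c → f (suc c)) (λ h → G (f zero ∷ᵛ h))
  expand₂-suc a b f {G} G-cong = begin
    expand₂ a b f G
      ≡⟨ laplace-suc (λ p → a (f p)) (λ p → expand₁ b (λ c → f (punchIn p c)) G) ⟩
    a (f zero) * E b + - laplace a′ (λ p → expand₁ b (λ c → f (punchIn (suc p) c)) G)
      ≡⟨ cong (λ x → a (f zero) * E b + - x) inner ⟩
    a (f zero) * E b + - (b (f zero) * E a + - T)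
      ≡⟨ rearrange (a (f zero) * E b) (b (f zero) * E a) T ⟩
    a (f zero) * E b + - (b (f zero) * E a) + T ∎
    where
    open ≡-Reasoning
    a′ = λ p → a (f (suc p))
    E : (X → ℤ) → ℤ
    E x = expand₁ x (λ c → f (suc c)) G
    T = expand₂ a b (λ c → f (suc c)) (λ h → G (f zero ∷ᵛ h))
    inner : laplace a′ (λ p → expand₁ b (λ c → f (punchIn (suc p) c)) G) ≡ b (f zero) * E a + - T
    inner = trans (laplace-congʳ a′ (expand₁-punchIn-suc b f G-cong))
              (trans (laplace-+ʳ a′ (λ p → b (f zero) * Gₚ p) (λ p → - Tₚ p))
                     (cong₂ _+_ (laplace-*ʳ (b (f zero)) a′ Gₚ) (laplace-negʳ a′ Tₚ)))
      where
      Gₚ = λ p → G (λ c → f (suc (punchIn p c)))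
      Tₚ = λ p → expand₁ b (λ c → f (suc (punchIn p c))) (λ h → G (f zero ∷ᵛ h))
    rearrange : ∀ x y t → x + - (y + - t) ≡ x + - y + t
    rearrange = solve-∀

  expand₂-antisym : ∀ {k} a b (f : Fin (ℕ.suc (ℕ.suc k)) → X) {G} → Congruent G →
    expand₂ a b f G + expand₂ b a f G ≡ 0ℤ
  expand₂-antisym {ℕ.zero} a b f {G} G-cong =
    trans (cong₂ _+_ (trans (expand₂-congᴳ a b f G≗g) (expand₂-two a b f _))
                     (trans (expand₂-congᴳ b a f G≗g) (expand₂-two b a f _)))
          (cancel (a (f zero)) (a (f (suc zero))) (b (f zero)) (b (f (suc zero))) (G (λ ())))
    where
    G≗g : ∀ h → G h ≡ G (λ ())
    G≗g h = G-cong (λ ())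
    cancel : ∀ a₀ a₁ b₀ b₁ g → (a₀ * b₁ + - (a₁ * b₀)) * g + (b₀ * a₁ + - (b₁ * a₀)) * g ≡ 0ℤ
    cancel = solve-∀
  expand₂-antisym {ℕ.suc k} a b f {G} G-cong =
    trans (cong₂ _+_ (expand₂-suc a b f G-cong) (expand₂-suc b a f G-cong))
          (cancel (a (f zero) * expand₁ b f′ G) (b (f zero) * expand₁ a f′ G)
                  (expand₂ a b f′ G₀) (expand₂ b a f′ G₀) (expand₂-antisym a b f′ G₀-cong))
    where
    f′ = λ c → f (suc c)
    G₀ = λ h → G (f zero ∷ᵛ h)
    G₀-cong : Congruent G₀
    G₀-cong {g} {h} g≗h = G-cong {f zero ∷ᵛ g} {f zero ∷ᵛ h} (λ { zero → refl ; (suc c) → g≗h c })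
    cancel : ∀ x y t t′ → t + t′ ≡ 0ℤ → (x + - y + t) + (y + - x + t′) ≡ 0ℤ
    cancel x y t t′ t+t′≡0 = trans (regroup x y t t′) t+t′≡0
      where
      regroup : ∀ x y t t′ → (x + - y + t) + (y + - x + t′) ≡ t + t′
      regroup = solve-∀

x+x≡0⇒x≡0 : ∀ (x : ℤ) → x + x ≡ 0ℤ → x ≡ 0ℤ
x+x≡0⇒x≡0 (ℤ.+ ℕ.zero)    _  = refl
x+x≡0⇒x≡0 (ℤ.+ ℕ.suc n)   ()
x+x≡0⇒x≡0 (ℤ.-[1+ n ])    ()

det-equalRows₀₁ : ∀ {k} (M : Matrix (2 ℕ.+ k)) → (∀ c → M zero c ≡ M (suc zero) c) → det M ≡ 0ℤ
det-equalRows₀₁ M row₀≡row₁ =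
  trans (laplace-cong {b = λ j → det (minor M j)} row₀≡row₁ (λ _ → refl))
        (x+x≡0⇒x≡0 _ (expand₂-antisym (M (suc zero)) (M (suc zero)) (λ c → c) G-cong))
  where
  open DoubleExpansion
  G-cong : Congruent (λ h → det (λ r c → M (suc (suc r)) (h c)))
  G-cong g≗h = det-cong (λ r c → cong (M (suc (suc r))) (g≗h c))

-- Alternating multilinear forms

record IsAlternatingMultilinear {n} (D : Matrix n → ℤ) : Set where
  field
    resp-≋      : ∀ {M N} → M ≋ N → D M ≡ D N
    linear-+    : ∀ M i (u v : Fin n → ℤ) → D (setRow M i (λ c → u c + v c)) ≡ D (setRow M i u) + D (setRow M i v)
    linear-*    : ∀ M i t (u : Fin n → ℤ) → D (setRow M i (λ c → t * u c)) ≡ t * D (setRow M i u)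
    alternating : ∀ M {i j} → i ≢ j → (∀ c → M i c ≡ M j c) → D M ≡ 0ℤ

module AlternatingMultilinear {n : ℕ} {D : Matrix n → ℤ} (isAM : IsAlternatingMultilinear D) where

  open IsAlternatingMultilinear isAM public

  setRow-zero : ∀ M i → D (setRow M i (λ _ → 0ℤ)) ≡ 0ℤ
  setRow-zero M i = linear-* M i 0ℤ (λ _ → 0ℤ)

  setRow-∑ : ∀ M i {m} (g : Fin m → Fin n → ℤ) → D (setRow M i (λ c → ∑ (λ l → g l c))) ≡ ∑ (λ l → D (setRow M i (g l)))
  setRow-∑ M i {ℕ.zero}  g = setRow-zero M i
  setRow-∑ M i {ℕ.suc m} g = trans (linear-+ M i (g zero) (λ c → ∑ (λ l → g (suc l) c)))
    (cong (D (setRow M i (g zero)) +_) (setRow-∑ M i (λ l → g (suc l))))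

  setRow-copy : ∀ M {p q} → p ≢ q → D (setRow M q (M p)) ≡ 0ℤ
  setRow-copy M {p} {q} p≢q = alternating (setRow M q (M p)) p≢q
    (λ c → trans (setRow-≢ M q (M p) p≢q c) (sym (setRow-≡ M q (M p) refl c)))

  addRowMultiple : ∀ M {p q} t → p ≢ q → D (setRow M q (λ c → M q c + t * M p c)) ≡ D M
  addRowMultiple M {p} {q} t p≢q = begin
    D (setRow M q (λ c → M q c + t * M p c))                 ≡⟨ linear-+ M q (M q) (λ c → t * M p c) ⟩
    D (setRow M q (M q)) + D (setRow M q (λ c → t * M p c))  ≡⟨ cong₂ _+_ (resp-≋ (setRow-self M q)) (linear-* M q t (M p)) ⟩
    D M + t * D (setRow M q (M p))                           ≡⟨ cong (λ x → D M + t * x) (setRow-copy M p≢q) ⟩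
    D M + t * 0ℤ                                             ≡⟨ cong (D M +_) (ℤP.*-zeroʳ t) ⟩
    D M + 0ℤ                                                 ≡⟨ ℤP.+-identityʳ (D M) ⟩
    D M                                                      ∎
    where open ≡-Reasoning

  swapRows-antisym : ∀ M {a b} → a ≢ b → D (swapRows M a b) ≡ - D M
  swapRows-antisym M {a} {b} a≢b =
    trans (inverseʳ-unique (W x y) (W y x) Wxy+Wyx≡0)
          (cong -_ (resp-≋ (λ r c → trans (setRow-cong b (setRow-self M a) (λ _ → refl) r c) (setRow-self M b r c))))
    where
    x = M a
    y = M b
    W : (Fin n → ℤ) → (Fin n → ℤ) → ℤ
    W u v = D (setRow (setRow M a u) b v)
    W-diag : ∀ u → W u u ≡ 0ℤ
    W-diag u = alternating _ a≢b (λ c → trans (setRow-≢ (setRow M a u) b u a≢b c)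
      (trans (setRow-≡ M a u refl c) (sym (setRow-≡ (setRow M a u) b u refl c))))
    W-+ˡ : ∀ u u′ v → W (λ c → u c + u′ c) v ≡ W u v + W u′ v
    W-+ˡ u u′ v = trans (resp-≋ (setRow-comm M _ v a≢b))
      (trans (linear-+ (setRow M b v) a u u′)
        (cong₂ _+_ (resp-≋ (setRow-comm M v u (λ b≡a → a≢b (sym b≡a))))
                   (resp-≋ (setRow-comm M v u′ (λ b≡a → a≢b (sym b≡a))))))
    W-+ʳ : ∀ u v v′ → W u (λ c → v c + v′ c) ≡ W u v + W u v′
    W-+ʳ u = linear-+ (setRow M a u) b
    Wxy+Wyx≡0 : W x y + W y x ≡ 0ℤ
    Wxy+Wyx≡0 = begin
      W x y + W y x                                     ≡⟨ pad (W x y) (W y x) ⟩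
      0ℤ + W x y + (W y x + 0ℤ)                         ≡⟨ sym (cong₂ (λ s t → s + W x y + (W y x + t)) (W-diag x) (W-diag y)) ⟩
      W x x + W x y + (W y x + W y y)                   ≡⟨ sym (cong₂ _+_ (W-+ʳ x x y) (W-+ʳ y x y)) ⟩
      W x (λ c → x c + y c) + W y (λ c → x c + y c)     ≡⟨ sym (W-+ˡ x y _) ⟩
      W (λ c → x c + y c) (λ c → x c + y c)             ≡⟨ W-diag _ ⟩
      0ℤ                                                ∎
      where
      open ≡-Reasoning
      pad : ∀ s t → s + t ≡ 0ℤ + s + (t + 0ℤ)
      pad = solve-∀

minor-swapRowsₛ : ∀ {n} (M : Matrix (ℕ.suc n)) a b j → minor (swapRows M (suc a) (suc b)) j ≋ swapRows (minor M j) a b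
minor-swapRowsₛ M a b j r c =
  trans (minor-setRowₛ (setRow M (suc a) (M (suc b))) b (M (suc a)) j r c)
        (setRow-cong b (minor-setRowₛ M a (M (suc b)) j) (λ _ → refl) r c)

-- Equal rows 0 and j+1 are reduced to equal rows 0 and 1 by swapping rows 1 and j+1,
-- which only involves minors and hence the smaller determinant.
mutual
  det-alternating : ∀ {n} (M : Matrix n) {i j} → i ≢ j → (∀ c → M i c ≡ M j c) → det M ≡ 0ℤ
  det-alternating M {zero}  {zero}  i≢j _    = ⊥-elim (i≢j refl)
  det-alternating M {zero}  {suc j} _   Mᵢ≗Mⱼ = det-equalRows₀ M j Mᵢ≗Mⱼ
  det-alternating M {suc i} {zero}  _   Mᵢ≗Mⱼ = det-equalRows₀ M i (λ c → sym (Mᵢ≗Mⱼ c))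
  det-alternating M {suc i} {suc j} i≢j Mᵢ≗Mⱼ = laplace-zeroʳ (M zero) (λ p → det (minor M p))
    (λ p → det-alternating (minor M p) (λ i≡j → i≢j (cong suc i≡j)) (λ c → Mᵢ≗Mⱼ (punchIn p c)))

  det-equalRows₀ : ∀ {n} (M : Matrix (ℕ.suc n)) j → (∀ c → M zero c ≡ M (suc j) c) → det M ≡ 0ℤ
  det-equalRows₀ M zero    M₀≗Mⱼ = det-equalRows₀₁ M M₀≗Mⱼ
  det-equalRows₀ M (suc j) M₀≗Mⱼ = begin
    det M           ≡⟨ sym (ℤP.neg-involutive (det M)) ⟩
    - - det M       ≡⟨ cong -_ (sym (det-swapRowsₛ M {zero} {suc j} (λ ()))) ⟩
    - det M′        ≡⟨ cong -_ (det-equalRows₀₁ M′ M′₀≗M′₁) ⟩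
    - 0ℤ            ∎
    where
    open ≡-Reasoning
    M′ = swapRows M (suc zero) (suc (suc j))
    M′₀≗M′₁ : ∀ c → M′ zero c ≡ M′ (suc zero) c
    M′₀≗M′₁ = M₀≗Mⱼ

  det-swapRowsₛ : ∀ {n} (M : Matrix (ℕ.suc n)) {a b} → a ≢ b → det (swapRows M (suc a) (suc b)) ≡ - det M
  det-swapRowsₛ M {a} {b} a≢b =
    trans (laplace-congʳ (M zero) (λ p → trans (det-cong (minor-swapRowsₛ M a b p))
                                                (swapRows-antisym (minor M p) a≢b)))
          (laplace-negʳ (M zero) (λ p → det (minor M p)))
    where open AlternatingMultilinear det-isAlternatingMultilinear

  det-isAlternatingMultilinear : ∀ {n} → IsAlternatingMultilinear (det {n})
  det-isAlternatingMultilinear = record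
    { resp-≋ = det-cong ; linear-+ = det-setRow-+ ; linear-* = det-setRow-* ; alternating = det-alternating }

δ-punchIn : ∀ {n} (j : Fin (ℕ.suc n)) r c → δ (punchIn j r) (punchIn j c) ≡ δ r c
δ-punchIn j r c = by-cases (r ≟ c)
  (λ r≡c → trans (δ-≡ (cong (punchIn j) r≡c)) (sym (δ-≡ r≡c)))
  (λ r≢c → trans (δ-≢ (λ p → r≢c (FinP.punchIn-injective j r c p))) (sym (δ-≢ r≢c)))

insertZero : ∀ {n} → Fin (ℕ.suc n) → (Fin n → ℤ) → Fin (ℕ.suc n) → ℤ
insertZero j w c with c ≟ j
... | yes _   = 0ℤ
... | no  c≢j = w (punchOut (λ j≡c → c≢j (sym j≡c)))

module _ {n : ℕ} (j : Fin (ℕ.suc n)) where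

  insertZero-at : ∀ w → insertZero j w j ≡ 0ℤ
  insertZero-at w with j ≟ j
  ... | yes _   = refl
  ... | no  j≢j = ⊥-elim (j≢j refl)

  insertZero-punchIn : ∀ w c → insertZero j w (punchIn j c) ≡ w c
  insertZero-punchIn w c with punchIn j c ≟ j
  ... | yes p = ⊥-elim (FinP.punchInᵢ≢i j c p)
  ... | no  _ = cong w (trans (FinP.punchOut-cong j refl) (FinP.punchOut-punchIn j))

  insertZero-unique : ∀ w (f : Fin (ℕ.suc n) → ℤ) → f j ≡ 0ℤ → (∀ c → f (punchIn j c) ≡ w c) → ∀ c → insertZero j w c ≡ f c
  insertZero-unique w f fⱼ≡0 f∘punchIn≗w c = by-cases (c ≟ j)
    (λ { refl → trans (insertZero-at w) (sym fⱼ≡0) })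
    (λ c≢j → let j≢c = λ j≡c → c≢j (sym j≡c) in
      trans (cong (insertZero j w) (sym (FinP.punchIn-punchOut j≢c)))
            (trans (insertZero-punchIn w _) (sym (trans (cong f (sym (FinP.punchIn-punchOut j≢c))) (f∘punchIn≗w _)))))

  insertZero-cong : ∀ {u v} → (∀ c → u c ≡ v c) → ∀ c → insertZero j u c ≡ insertZero j v c
  insertZero-cong {u} {v} u≗v = insertZero-unique u (insertZero j v) (insertZero-at v)
    (λ c → trans (insertZero-punchIn v c) (sym (u≗v c)))

  insertZero-+ : ∀ u v c → insertZero j (λ c → u c + v c) c ≡ insertZero j u c + insertZero j v c
  insertZero-+ u v = insertZero-unique _ (λ c → insertZero j u c + insertZero j v c)
    (cong₂ _+_ (insertZero-at u) (insertZero-at v)) (λ c → cong₂ _+_ (insertZero-punchIn u c) (insertZero-punchIn v c))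

  insertZero-* : ∀ t u c → insertZero j (λ c → t * u c) c ≡ t * insertZero j u c
  insertZero-* t u = insertZero-unique _ (λ c → t * insertZero j u c)
    (trans (cong (t *_) (insertZero-at u)) (ℤP.*-zeroʳ t)) (λ c → cong (t *_) (insertZero-punchIn u c))

  insertZero-δ : ∀ r c → insertZero j (δ r) c ≡ δ (punchIn j r) c
  insertZero-δ r = insertZero-unique (δ r) (δ (punchIn j r)) (δ-≢ (FinP.punchInᵢ≢i j r)) (δ-punchIn j r)

extend : ∀ {n} → Fin (ℕ.suc n) → Matrix n → Matrix (ℕ.suc n)
extend j N zero    = δ j
extend j N (suc r) = insertZero j (N r)

extend-setRow : ∀ {n} j (N : Matrix n) i w → extend j (setRow N i w) ≋ setRow (extend j N) (suc i) (insertZero j w)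
extend-setRow j N i w zero    c = refl
extend-setRow j N i w (suc r) c = by-cases (r ≟ i)
  (λ r≡i → trans (insertZero-cong j (setRow-≡ N i w r≡i) c) (sym (setRow-≡ (extend j N) (suc i) _ (cong suc r≡i) c)))
  (λ r≢i → trans (insertZero-cong j (setRow-≢ N i w r≢i) c)
                 (sym (setRow-≢ (extend j N) (suc i) _ (λ p → r≢i (FinP.suc-injective p)) c)))

addMultiplesOfRow₀ : ∀ {n} → Matrix (ℕ.suc n) → (Fin n → ℤ) → Matrix (ℕ.suc n)
addMultiplesOfRow₀ K t zero      = K zero
addMultiplesOfRow₀ K t (suc r) c = K (suc r) c + t r * K zero c

punchIn-inject₁-self : ∀ {n} (ι : Fin n) → punchIn (inject₁ ι) ι ≡ suc ι
punchIn-inject₁-self zero    = refl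
punchIn-inject₁-self (suc ι) = cong suc (punchIn-inject₁-self ι)

punchIn-suc-self : ∀ {n} (ι : Fin n) → punchIn (suc ι) ι ≡ inject₁ ι
punchIn-suc-self zero    = refl
punchIn-suc-self (suc ι) = cong suc (punchIn-suc-self ι)

punchIn-suc≡punchIn-inject₁ : ∀ {n} {ι r : Fin n} → r ≢ ι → punchIn (suc ι) r ≡ punchIn (inject₁ ι) r
punchIn-suc≡punchIn-inject₁ {ι = zero}   {zero}  r≢ι = ⊥-elim (r≢ι refl)
punchIn-suc≡punchIn-inject₁ {ι = zero}   {suc r} r≢ι = refl
punchIn-suc≡punchIn-inject₁ {ι = suc ι}  {zero}  r≢ι = refl
punchIn-suc≡punchIn-inject₁ {ι = suc ι}  {suc r} r≢ι = cong suc (punchIn-suc≡punchIn-inject₁ (λ p → r≢ι (cong suc p)))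

permutation : ∀ {n} → Fin (ℕ.suc n) → Matrix (ℕ.suc n)
permutation j = extend j I

permutation-zero : ∀ {n} → permutation {n} zero ≋ I
permutation-zero zero    c = refl
permutation-zero (suc r) c = insertZero-δ zero r c

permutation-suc : ∀ {n} (ι : Fin n) → permutation (suc ι) ≋ swapRows (permutation (inject₁ ι)) zero (suc ι)
permutation-suc ι zero c =
  sym (trans (insertZero-δ (inject₁ ι) ι c) (cong (λ x → δ x c) (punchIn-inject₁-self ι)))
permutation-suc ι (suc r) c = by-cases (r ≟ ι)
  (λ r≡ι → trans (insertZero-δ (suc ι) r c) (trans (cong (λ x → δ (punchIn (suc ι) x) c) r≡ι)
    (trans (cong (λ x → δ x c) (punchIn-suc-self ι)) (sym (setRow-≡ P′ (suc ι) (P zero) (cong suc r≡ι) c)))))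
  (λ r≢ι → trans (insertZero-δ (suc ι) r c) (trans (cong (λ x → δ x c) (punchIn-suc≡punchIn-inject₁ r≢ι))
    (trans (sym (insertZero-δ (inject₁ ι) r c))
      (sym (trans (setRow-≢ P′ (suc ι) (P zero) (λ p → r≢ι (FinP.suc-injective p)) c)
                  (setRow-≢ P zero (P (suc ι)) {suc r} (λ ()) c))))))
  where
  P = permutation (inject₁ ι)
  P′ = setRow P zero (P (suc ι))

module AlternatingMultilinearSuc {n : ℕ} {D : Matrix (ℕ.suc n) → ℤ} (isAM : IsAlternatingMultilinear D) where

  open AlternatingMultilinear isAM

  extend-isAlternatingMultilinear : ∀ j → IsAlternatingMultilinear (λ N → D (extend j N))
  extend-isAlternatingMultilinear j = record
    { resp-≋ = λ N≋N′ → resp-≋ (λ { zero c → refl ; (suc r) c → insertZero-cong j (N≋N′ r) c })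
    ; linear-+ = λ N i u v → begin
        D (extend j (setRow N i (λ c → u c + v c)))
          ≡⟨ resp-≋ (extend-setRow j N i _) ⟩
        D (setRow (extend j N) (suc i) (insertZero j (λ c → u c + v c)))
          ≡⟨ resp-≋ (setRow-cong (suc i) (λ _ _ → refl) (insertZero-+ j u v)) ⟩
        D (setRow (extend j N) (suc i) (λ c → insertZero j u c + insertZero j v c))
          ≡⟨ linear-+ (extend j N) (suc i) (insertZero j u) (insertZero j v) ⟩
        D (setRow (extend j N) (suc i) (insertZero j u)) + D (setRow (extend j N) (suc i) (insertZero j v))
          ≡⟨ sym (cong₂ _+_ (resp-≋ (extend-setRow j N i u)) (resp-≋ (extend-setRow j N i v))) ⟩
        D (extend j (setRow N i u)) + D (extend j (setRow N i v)) ∎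
    ; linear-* = λ N i t u → begin
        D (extend j (setRow N i (λ c → t * u c)))
          ≡⟨ resp-≋ (extend-setRow j N i _) ⟩
        D (setRow (extend j N) (suc i) (insertZero j (λ c → t * u c)))
          ≡⟨ resp-≋ (setRow-cong (suc i) (λ _ _ → refl) (insertZero-* j t u)) ⟩
        D (setRow (extend j N) (suc i) (λ c → t * insertZero j u c))
          ≡⟨ linear-* (extend j N) (suc i) t (insertZero j u) ⟩
        t * D (setRow (extend j N) (suc i) (insertZero j u))
          ≡⟨ cong (t *_) (sym (resp-≋ (extend-setRow j N i u))) ⟩
        t * D (extend j (setRow N i u)) ∎
    ; alternating = λ N i≢i′ Nᵢ≗Nᵢ′ →
        alternating (extend j N) (λ p → i≢i′ (FinP.suc-injective p)) (insertZero-cong j Nᵢ≗Nᵢ′)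
    }
    where open ≡-Reasoning

  addMultiplesOfRow₀-invariant : ∀ K (t : Fin n → ℤ) → D (addMultiplesOfRow₀ K t) ≡ D K
  addMultiplesOfRow₀-invariant K t = go (allFin n) t (λ r _ → ∈-allFin r)
    where
    go : ∀ (σs : List (Fin n)) t → (∀ r → ¬ (t r ≡ 0ℤ) → r ∈ σs) → D (addMultiplesOfRow₀ K t) ≡ D K
    go []       t supp = resp-≋ λ
      { zero c    → refl
      ; (suc r) c → by-cases (t r ℤ.≟ 0ℤ)
          (λ tᵣ≡0 → trans (cong (λ x → K (suc r) c + x * K zero c) tᵣ≡0) (ℤP.+-identityʳ (K (suc r) c)))
          (λ tᵣ≢0 → case supp r tᵣ≢0 of λ ()) }
    go (σ ∷ σs) t supp = trans (resp-≋ split) (trans (addRowMultiple K′ {zero} {suc σ} (t σ) (λ ())) (go σs t′ supp′))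
      where
      t′ = updateAt t σ (λ _ → 0ℤ)
      K′ = addMultiplesOfRow₀ K t′
      supp′ : ∀ r → ¬ (t′ r ≡ 0ℤ) → r ∈ σs
      supp′ r t′ᵣ≢0 = by-cases (r ≟ σ)
        (λ { refl → ⊥-elim (t′ᵣ≢0 (updateAt-updates r t)) })
        (λ r≢σ → case supp r (λ tᵣ≡0 → t′ᵣ≢0 (trans (updateAt-minimal r σ t r≢σ) tᵣ≡0)) of λ
          { (here r≡σ) → ⊥-elim (r≢σ r≡σ) ; (there r∈σs) → r∈σs })
      split : addMultiplesOfRow₀ K t ≋ setRow K′ (suc σ) (λ c → K′ (suc σ) c + t σ * K′ zero c)
      split zero    c = refl
      split (suc r) c = by-cases (r ≟ σ)
        (λ { refl → trans (cong (_+ t r * K zero c) (sym (trans (cong (λ x → K (suc r) c + x * K zero c) (updateAt-updates r t))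
                                                                 (ℤP.+-identityʳ (K (suc r) c)))))
                          (sym (setRow-≡ K′ (suc r) (λ c → K′ (suc r) c + t r * K′ zero c) refl c)) })
        (λ r≢σ → trans (cong (λ x → K (suc r) c + x * K zero c) (sym (updateAt-minimal r σ t r≢σ)))
                       (sym (setRow-≢ K′ (suc σ) _ (λ p → r≢σ (FinP.suc-injective p)) c)))

  setRow₀-δ : ∀ M j → D (setRow M zero (δ j)) ≡ D (extend j (minor M j))
  setRow₀-δ M j = trans (sym (addMultiplesOfRow₀-invariant K t)) (resp-≋ cleared)
    where
    K = setRow M zero (δ j)
    t = λ r → - M (suc r) j
    cleared : addMultiplesOfRow₀ K t ≋ extend j (minor M j)
    cleared zero    c = refl
    cleared (suc r) c = sym (insertZero-unique j (minor M j r) (λ c → M (suc r) c + - M (suc r) j * δ j c)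
      (trans (cong (λ x → M (suc r) j + - M (suc r) j * x) (δ-≡ {i = j} refl)) (cancel (M (suc r) j)))
      (λ c → trans (cong (λ x → M (suc r) (punchIn j c) + - M (suc r) j * x) (δ-≢ (λ p → FinP.punchInᵢ≢i j c (sym p))))
                   (cancel₀ (M (suc r) (punchIn j c)) (M (suc r) j)))
      c)
      where
      cancel : ∀ x → x + - x * 1ℤ ≡ 0ℤ
      cancel = solve-∀
      cancel₀ : ∀ x y → x + - y * 0ℤ ≡ x
      cancel₀ = solve-∀

  permutation-sign : ∀ (k : ℕ) (j : Fin (ℕ.suc n)) → toℕ j ≡ k → D (permutation j) ≡ sgn k * D I
  permutation-sign ℕ.zero    zero    _ = trans (resp-≋ permutation-zero) (sym (ℤP.*-identityˡ (D I)))
  permutation-sign (ℕ.suc k) (suc ι) j≡k = begin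
    D (permutation (suc ι))                                 ≡⟨ resp-≋ (permutation-suc ι) ⟩
    D (swapRows (permutation (inject₁ ι)) zero (suc ι))     ≡⟨ swapRows-antisym _ {zero} {suc ι} (λ ()) ⟩
    - D (permutation (inject₁ ι))                           ≡⟨ cong -_ (permutation-sign k (inject₁ ι) ι≡k) ⟩
    - (sgn k * D I)                                         ≡⟨ ℤP.neg-distribˡ-* (sgn k) (D I) ⟩
    - sgn k * D I                                           ≡⟨ cong (_* D I) (sym (sgn-suc k)) ⟩
    sgn (ℕ.suc k) * D I                                     ∎
    where
    open ≡-Reasoning
    ι≡k = trans (FinP.toℕ-inject₁ ι) (ℕP.suc-injective j≡k)

-- Expand row 0 by linearity, clear column j below e_j by row operations, and recurse on the minor.
det-unique : ∀ {n} {D : Matrix n → ℤ} → IsAlternatingMultilinear D → ∀ M → D M ≡ det M * D I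
det-unique {ℕ.zero}  {D} isAM M = trans (IsAlternatingMultilinear.resp-≋ isAM (λ ())) (sym (ℤP.*-identityˡ (D I)))
det-unique {ℕ.suc n} {D} isAM M = begin
  D M
    ≡⟨ resp-≋ (λ r c → trans (setRow-cong zero (λ _ _ → refl) (∑-*-δ (M zero)) r c) (setRow-self M zero r c)) ⟨
  D (setRow M zero (λ c → ∑ (λ j → M zero j * δ j c)))
    ≡⟨ setRow-∑ M zero (λ j c → M zero j * δ j c) ⟩
  ∑ (λ j → D (setRow M zero (λ c → M zero j * δ j c)))
    ≡⟨ ∑-cong (λ j → linear-* M zero (M zero j) (δ j)) ⟩
  ∑ (λ j → M zero j * D (setRow M zero (δ j)))
    ≡⟨ ∑-cong (λ j → cong (M zero j *_)
         (trans (setRow₀-δ M j) (det-unique (extend-isAlternatingMultilinear j) (minor M j)))) ⟩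
  ∑ (λ j → M zero j * (det (minor M j) * D (permutation j)))
    ≡⟨ ∑-cong (λ j → cong (λ x → M zero j * (det (minor M j) * x)) (permutation-sign (toℕ j) j refl)) ⟩
  ∑ (λ j → M zero j * (det (minor M j) * (sgn (toℕ j) * D I)))
    ≡⟨ ∑-cong (λ j → reassoc (M zero j) (det (minor M j)) (sgn (toℕ j)) (D I)) ⟩
  ∑ (λ j → sgn (toℕ j) * (M zero j * det (minor M j)) * D I)
    ≡⟨ ∑-distribʳ-* (λ j → sgn (toℕ j) * (M zero j * det (minor M j))) (D I) ⟩
  det M * D I ∎
  where
  open ≡-Reasoning
  open AlternatingMultilinear isAM
  open AlternatingMultilinearSuc isAM
  reassoc : ∀ m d s x → m * (d * (s * x)) ≡ s * (m * d) * x
  reassoc = solve-∀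

-- Multiplicativity and Cramer's rule

mutual
  det-zeroColumn₀ : ∀ {n} (M : Matrix (ℕ.suc n)) → (∀ r → M r zero ≡ 0ℤ) → det M ≡ 0ℤ
  det-zeroColumn₀ M col₀≡0 = begin
    det M
      ≡⟨ laplace-suc (M zero) (λ j → det (minor M j)) ⟩
    M zero zero * det (minor M zero) + - laplace (λ j → M zero (suc j)) (λ j → det (minor M (suc j)))
      ≡⟨ cong₂ (λ x y → x * det (minor M zero) + - y) (col₀≡0 zero)
               (laplace-zeroʳ (λ j → M zero (suc j)) (λ j → det (minor M (suc j))) (det-minorₛ-zeroColumn₀ M (λ r → col₀≡0 (suc r)))) ⟩
    0ℤ ∎
    where open ≡-Reasoning

  det-minorₛ-zeroColumn₀ : ∀ {n} (M : Matrix (ℕ.suc n)) → (∀ r → M (suc r) zero ≡ 0ℤ) → ∀ j → det (minor M (suc j)) ≡ 0ℤ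
  det-minorₛ-zeroColumn₀ {ℕ.suc n} M col₀≡0 j = det-zeroColumn₀ (minor M (suc j)) col₀≡0

UpperUnitriangular : ∀ {n} → Matrix n → Set
UpperUnitriangular U = (∀ i j → toℕ j < toℕ i → U i j ≡ 0ℤ) × (∀ i → U i i ≡ 1ℤ)

det-upperUnitriangular : ∀ {n} (U : Matrix n) → UpperUnitriangular U → det U ≡ 1ℤ
det-upperUnitriangular {ℕ.zero}  U _ = refl
det-upperUnitriangular {ℕ.suc n} U (below≡0 , diag≡1) = begin
  det U
    ≡⟨ laplace-suc (U zero) (λ j → det (minor U j)) ⟩
  U zero zero * det (minor U zero) + - laplace (λ j → U zero (suc j)) (λ j → det (minor U (suc j)))
    ≡⟨ cong₂ (λ x y → x * y + - laplace (λ j → U zero (suc j)) (λ j → det (minor U (suc j)))) (diag≡1 zero)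
             (det-upperUnitriangular (minor U zero) ((λ i j j<i → below≡0 (suc i) (suc j) (s≤s j<i)) , (λ i → diag≡1 (suc i)))) ⟩
  1ℤ * 1ℤ + - laplace (λ j → U zero (suc j)) (λ j → det (minor U (suc j)))
    ≡⟨ cong (λ y → 1ℤ * 1ℤ + - y) (laplace-zeroʳ (λ j → U zero (suc j)) (λ j → det (minor U (suc j))) (det-minorₛ-zeroColumn₀ U (λ r → below≡0 (suc r) zero (s≤s z≤n)))) ⟩
  1ℤ ∎
  where open ≡-Reasoning

I-upperUnitriangular : ∀ {n} → UpperUnitriangular (I {n})
I-upperUnitriangular = (λ i j j<i → δ-≢ (λ i≡j → ℕP.<-irrefl (cong toℕ (sym i≡j)) j<i)) , (λ i → δ-≡ {i = i} refl)

det-I : ∀ {n} → det (I {n}) ≡ 1ℤ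
det-I {n} = det-upperUnitriangular (I {n}) I-upperUnitriangular

I-⊗ : ∀ {n} (C : Matrix n) → I ⊗ C ≋ C
I-⊗ C i c = ∑-δ-* (λ l → C l c) i

infixl 7 _⊗ᵣ_
_⊗ᵣ_ : ∀ {n} → (Fin n → ℤ) → Matrix n → Fin n → ℤ
(w ⊗ᵣ C) c = ∑ (λ l → w l * C l c)

setRow-⊗ : ∀ {n} (B C : Matrix n) i w → setRow B i w ⊗ C ≋ setRow (B ⊗ C) i (w ⊗ᵣ C)
setRow-⊗ B C i w r c = by-cases (r ≟ i)
  (λ r≡i → trans (∑-cong (λ l → cong (_* C l c) (setRow-≡ B i w r≡i l))) (sym (setRow-≡ (B ⊗ C) i _ r≡i c)))
  (λ r≢i → trans (∑-cong (λ l → cong (_* C l c) (setRow-≢ B i w r≢i l))) (sym (setRow-≢ (B ⊗ C) i _ r≢i c)))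

⊗-isAlternatingMultilinear : ∀ {n} (C : Matrix n) → IsAlternatingMultilinear (λ B → det (B ⊗ C))
⊗-isAlternatingMultilinear {n} C = record
  { resp-≋ = λ B≋B′ → det-cong (λ r c → ∑-cong (λ l → cong (_* C l c) (B≋B′ r l)))
  ; linear-+ = λ B i u v → begin
      det (setRow B i (λ c → u c + v c) ⊗ C)
        ≡⟨ det-cong (setRow-⊗ B C i _) ⟩
      det (setRow (B ⊗ C) i ((λ c → u c + v c) ⊗ᵣ C))
        ≡⟨ det-cong (setRow-cong i (λ _ _ → refl) (λ c → trans (∑-cong (λ l → ℤP.*-distribʳ-+ (C l c) (u l) (v l)))
                                                             (∑-distrib-+ (λ l → u l * C l c) (λ l → v l * C l c)))) ⟩
      det (setRow (B ⊗ C) i (λ c → (u ⊗ᵣ C) c + (v ⊗ᵣ C) c))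
        ≡⟨ det-setRow-+ (B ⊗ C) i (u ⊗ᵣ C) (v ⊗ᵣ C) ⟩
      det (setRow (B ⊗ C) i (u ⊗ᵣ C)) + det (setRow (B ⊗ C) i (v ⊗ᵣ C))
        ≡⟨ sym (cong₂ _+_ (det-cong (setRow-⊗ B C i u)) (det-cong (setRow-⊗ B C i v))) ⟩
      det (setRow B i u ⊗ C) + det (setRow B i v ⊗ C) ∎
  ; linear-* = λ B i t u → begin
      det (setRow B i (λ c → t * u c) ⊗ C)
        ≡⟨ det-cong (setRow-⊗ B C i _) ⟩
      det (setRow (B ⊗ C) i ((λ c → t * u c) ⊗ᵣ C))
        ≡⟨ det-cong (setRow-cong i (λ _ _ → refl) (λ c → trans (∑-cong (λ l → ℤP.*-assoc t (u l) (C l c)))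
                                                             (∑-distribˡ-* t (λ l → u l * C l c)))) ⟩
      det (setRow (B ⊗ C) i (λ c → t * (u ⊗ᵣ C) c))
        ≡⟨ det-setRow-* (B ⊗ C) i t (u ⊗ᵣ C) ⟩
      t * det (setRow (B ⊗ C) i (u ⊗ᵣ C))
        ≡⟨ cong (t *_) (sym (det-cong (setRow-⊗ B C i u))) ⟩
      t * det (setRow B i u ⊗ C) ∎
  ; alternating = λ B i≢j Bᵢ≗Bⱼ → det-alternating (B ⊗ C) i≢j (λ c → ∑-cong (λ l → cong (_* C l c) (Bᵢ≗Bⱼ l)))
  }
  where open ≡-Reasoning

det-⊗ : ∀ {n} (B C : Matrix n) → det (B ⊗ C) ≡ det B * det C
det-⊗ B C = trans (det-unique (⊗-isAlternatingMultilinear C) B) (cong (det B *_) (det-cong (I-⊗ C)))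

det-setRow-I : ∀ {n} (q : Fin n) (v : Fin n → ℤ) → det (setRow I q v) ≡ v q
det-setRow-I {n} q v = begin
  det (setRow I q v)                                     ≡⟨ det-cong (setRow-cong q (λ _ _ → refl) (λ c → sym (∑-*-δ v c))) ⟩
  det (setRow I q (λ c → ∑ (λ j → v j * δ j c)))         ≡⟨ setRow-∑ I q (λ j c → v j * δ j c) ⟩
  ∑ (λ j → det (setRow I q (λ c → v j * δ j c)))         ≡⟨ ∑-cong (λ j → det-setRow-* I q (v j) (δ j)) ⟩
  ∑ (λ j → v j * det (setRow I q (δ j)))                 ≡⟨ ∑-single _ q (λ j j≢q → trans (cong (v j *_) (setRow-copy I j≢q)) (ℤP.*-zeroʳ (v j))) ⟩
  v q * det (setRow I q (δ q))                           ≡⟨ cong (v q *_) (trans (det-cong (setRow-self I q)) (det-I {n})) ⟩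
  v q * 1ℤ                                               ≡⟨ ℤP.*-identityʳ (v q) ⟩
  v q                                                    ∎
  where
  open ≡-Reasoning
  open AlternatingMultilinear (det-isAlternatingMultilinear {n})

module Cramer {n : ℕ} (v : Fin n → ℤ) (q : Fin n) where

  open AlternatingMultilinear (det-isAlternatingMultilinear {n})

  summand : Matrix n → Fin n → ℤ
  summand C l = det (setRow C l v) * C l q

  summand-setRow-≡ : ∀ C {i l} x → l ≡ i → summand (setRow C i x) l ≡ det (setRow C l v) * x q
  summand-setRow-≡ C {l = l} x refl = cong₂ _*_ (det-cong (setRow-setRow C l x v)) (setRow-≡ C l x refl q)

  summand-setRow-≢ : ∀ C {i l} x → l ≢ i → summand (setRow C i x) l ≡ det (setRow (setRow C l v) i x) * C l q
  summand-setRow-≢ C {i} {l} x l≢i =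
    cong₂ _*_ (det-cong (setRow-comm C x v (λ i≡l → l≢i (sym i≡l)))) (setRow-≢ C i x l≢i q)

  summand-+ : ∀ C i u w l →
    summand (setRow C i (λ c → u c + w c)) l ≡ summand (setRow C i u) l + summand (setRow C i w) l
  summand-+ C i u w l = by-cases (l ≟ i)
    (λ l≡i → trans (summand-setRow-≡ C _ l≡i)
      (trans (ℤP.*-distribˡ-+ (det (setRow C l v)) (u q) (w q))
             (sym (cong₂ _+_ (summand-setRow-≡ C u l≡i) (summand-setRow-≡ C w l≡i)))))
    (λ l≢i → trans (summand-setRow-≢ C _ l≢i)
      (trans (cong (_* C l q) (det-setRow-+ (setRow C l v) i u w))
        (trans (ℤP.*-distribʳ-+ (C l q) (det (setRow (setRow C l v) i u)) (det (setRow (setRow C l v) i w)))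
               (sym (cong₂ _+_ (summand-setRow-≢ C u l≢i) (summand-setRow-≢ C w l≢i))))))

  summand-* : ∀ C i t u l → summand (setRow C i (λ c → t * u c)) l ≡ t * summand (setRow C i u) l
  summand-* C i t u l = by-cases (l ≟ i)
    (λ l≡i → trans (summand-setRow-≡ C _ l≡i)
      (trans (swap-factor (det (setRow C l v)) t (u q)) (sym (cong (t *_) (summand-setRow-≡ C u l≡i)))))
    (λ l≢i → trans (summand-setRow-≢ C _ l≢i)
      (trans (cong (_* C l q) (det-setRow-* (setRow C l v) i t u))
        (trans (ℤP.*-assoc t (det (setRow (setRow C l v) i u)) (C l q)) (sym (cong (t *_) (summand-setRow-≢ C u l≢i))))))
    where
    swap-factor : ∀ d t x → d * (t * x) ≡ t * (d * x)
    swap-factor = solve-∀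

  -- With rows a and b of C equal, only the summands l = a, b survive, and they cancel.
  summand-equalRows : ∀ C {a b} → a ≢ b → (∀ c → C a c ≡ C b c) → summand C b ≡ - summand C a
  summand-equalRows C {a} {b} a≢b Cₐ≗C_b = begin
    det (setRow C b v) * C b q         ≡⟨ cong₂ _*_ (det-cong C[b≔v]≋swapped) (sym (Cₐ≗C_b q)) ⟩
    det (swapRows C[a≔v] a b) * C a q  ≡⟨ cong (_* C a q) (swapRows-antisym C[a≔v] a≢b) ⟩
    - det C[a≔v] * C a q               ≡⟨ sym (ℤP.neg-distribˡ-* (det C[a≔v]) (C a q)) ⟩
    - (det C[a≔v] * C a q)             ∎
    where
    open ≡-Reasoning
    b≢a = λ b≡a → a≢b (sym b≡a)
    C[a≔v] = setRow C a v
    C[a≔Cₐ]≋C : setRow C a (C b) ≋ C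
    C[a≔Cₐ]≋C r c = trans (setRow-cong a (λ _ _ → refl) (λ c → sym (Cₐ≗C_b c)) r c) (setRow-self C a r c)
    C[b≔v]≋swapped : setRow C b v ≋ swapRows C[a≔v] a b
    C[b≔v]≋swapped r c = sym (trans
      (setRow-cong b (λ r c → trans (setRow-setRow C a v (C[a≔v] b) r c)
                                    (trans (setRow-cong a (λ _ _ → refl) (setRow-≢ C a v b≢a) r c) (C[a≔Cₐ]≋C r c)))
                     (setRow-≡ C a v refl) r c)
      (setRow-cong b (λ _ _ → refl) (λ _ → refl) r c))

  isAlternatingMultilinear : IsAlternatingMultilinear (λ C → ∑ (summand C))
  isAlternatingMultilinear = record
    { resp-≋ = λ C≋C′ → ∑-cong (λ l → cong₂ _*_ (det-cong (setRow-cong l C≋C′ (λ _ → refl))) (C≋C′ l q))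
    ; linear-+ = λ C i u w → trans (∑-cong (summand-+ C i u w))
        (∑-distrib-+ (summand (setRow C i u)) (summand (setRow C i w)))
    ; linear-* = λ C i t u → trans (∑-cong (summand-* C i t u)) (∑-distribˡ-* t (summand (setRow C i u)))
    ; alternating = λ C {a} {b} a≢b Cₐ≗C_b →
        trans (∑-pair (summand C) a≢b (λ l l≢a l≢b → trans (cong (_* C l q)
                 (det-alternating (setRow C l v) a≢b (λ c → trans (setRow-≢ C l v (λ a≡l → l≢a (sym a≡l)) c)
                   (trans (Cₐ≗C_b c) (sym (setRow-≢ C l v (λ b≡l → l≢b (sym b≡l)) c)))))) (ℤP.*-zeroˡ (C l q))))
              (trans (cong (summand C a +_) (summand-equalRows C a≢b Cₐ≗C_b)) (ℤP.+-inverseʳ (summand C a)))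
    }

  summand-I : ∑ (summand I) ≡ v q
  summand-I = trans (∑-*-δ (λ l → det (setRow I l v)) q) (det-setRow-I q v)

cramer : ∀ {n} (C : Matrix n) (v : Fin n → ℤ) q → ∑ (λ l → det (setRow C l v) * C l q) ≡ det C * v q
cramer C v q = trans (det-unique (Cramer.isAlternatingMultilinear v q) C) (cong (det C *_) (Cramer.summand-I v q))

-- Minors of the bottom rows

punchIn-≥ : ∀ {n} {i : Fin (ℕ.suc n)} {j : Fin n} → toℕ i ≤ toℕ j → punchIn i j ≡ suc j
punchIn-≥ {i = zero}              _          = refl
punchIn-≥ {i = suc i} {suc j} (s≤s i≤j) = cong suc (punchIn-≥ i≤j)

toℕ-punchIn-cong : ∀ {n n′} {i : Fin (ℕ.suc n)} {i′ : Fin (ℕ.suc n′)} {j : Fin n} {j′ : Fin n′} →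
  toℕ i ≡ toℕ i′ → toℕ j ≡ toℕ j′ → toℕ (punchIn i j) ≡ toℕ (punchIn i′ j′)
toℕ-punchIn-cong {i = zero}  {zero}                   _    j≡j′ = cong ℕ.suc j≡j′
toℕ-punchIn-cong {i = suc i} {suc i′} {zero}  {zero}  _    _    = refl
toℕ-punchIn-cong {i = suc i} {suc i′} {suc j} {suc j′} i≡i′ j≡j′ =
  cong ℕ.suc (toℕ-punchIn-cong (ℕP.suc-injective i≡i′) (ℕP.suc-injective j≡j′))

punchIn-strictlyIncreasing : ∀ {k n} (j : Fin (ℕ.suc n)) {c : Fin k → Fin n} →
  StrictlyIncreasing c → StrictlyIncreasing (λ s → punchIn j (c s))
punchIn-strictlyIncreasing j {c} c↑ a b a<b = ℕP.≤∧≢⇒<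
  (FinP.punchIn-mono-≤ j (c a) (c b) (<⇒≤ (c↑ a b a<b)))
  (λ eq → ℕP.<-irrefl (cong toℕ (FinP.punchIn-injective j (c a) (c b) (FinP.toℕ-injective eq))) (c↑ a b a<b))

δ-shift : ∀ {n} (j : Fin (ℕ.suc n)) r c → toℕ j ≤ toℕ r → δ (suc r) (punchIn j c) ≡ δ r c
δ-shift j r c j≤r = trans (cong (λ x → δ x (punchIn j c)) (sym (punchIn-≥ j≤r))) (δ-punchIn j r c)

det-zeroRow : ∀ {n} (M : Matrix n) i → (∀ c → M i c ≡ 0ℤ) → det M ≡ 0ℤ
det-zeroRow M i Mᵢ≗0 = trans (det-cong (λ r c → trans (sym (setRow-self M i r c)) (setRow-cong i (λ _ _ → refl) Mᵢ≗0 r c)))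
                             (setRow-zero M i)
  where open AlternatingMultilinear det-isAlternatingMultilinear

toℕ-bottomRow : ∀ {n k} (k≤n : k ≤ n) i → toℕ (bottomRow k≤n i) ≡ n ∸ k ℕ.+ toℕ i
toℕ-bottomRow k≤n i = FinP.toℕ-fromℕ< _

bottomRow-≥ : ∀ {n k} (k≤n : k ≤ n) i → n ∸ k ≤ toℕ (bottomRow k≤n i)
bottomRow-≥ {n} {k} k≤n i = subst (n ∸ k ≤_) (sym (toℕ-bottomRow k≤n i)) (ℕP.m≤m+n (n ∸ k) (toℕ i))

toℕ-topIndex : ∀ {n p} (p≤n : p ≤ n) i → toℕ (topIndex p≤n i) ≡ toℕ i
toℕ-topIndex p≤n i = FinP.toℕ-fromℕ< _

∑-vanishing-prefix : ∀ d {k n} → d ℕ.+ k ≡ n → (g : Fin n → ℤ) → (∀ l → toℕ l < d → g l ≡ 0ℤ) →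
  (emb : Fin k → Fin n) → (∀ i → toℕ (emb i) ≡ d ℕ.+ toℕ i) → ∑ g ≡ ∑ (λ i → g (emb i))
∑-vanishing-prefix ℕ.zero     refl g _       emb emb≡ = ∑-cong (λ i → cong g (FinP.toℕ-injective (sym (emb≡ i))))
∑-vanishing-prefix (ℕ.suc d) {k} refl g prefix≡0 emb emb≡ =
  trans (cong₂ _+_ (prefix≡0 zero (s≤s z≤n))
                   (∑-vanishing-prefix d refl (λ l → g (suc l)) (λ l l<d → prefix≡0 (suc l) (s≤s l<d)) emb′ emb′≡))
        (trans (ℤP.+-identityˡ _) (∑-cong (λ i → cong g (FinP.toℕ-injective (trans (cong ℕ.suc (emb′≡ i)) (sym (emb≡ i)))))))
  where
  emb′ : Fin k → Fin (d ℕ.+ k)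
  emb′ i = fromℕ< (ℕP.+-monoʳ-< d (FinP.toℕ<n i))
  emb′≡ : ∀ i → toℕ (emb′ i) ≡ d ℕ.+ toℕ i
  emb′≡ i = FinP.toℕ-fromℕ< _

∑-vanishing-suffix : ∀ {p n} → p ≤ n → (g : Fin n → ℤ) → (∀ l → p ≤ toℕ l → g l ≡ 0ℤ) →
  (emb : Fin p → Fin n) → (∀ i → toℕ (emb i) ≡ toℕ i) → ∑ g ≡ ∑ (λ i → g (emb i))
∑-vanishing-suffix {ℕ.zero}  _         g suffix≡0 _   _    = ∑-zero g (λ l → suffix≡0 l z≤n)
∑-vanishing-suffix {ℕ.suc p} (s≤s p≤n) g suffix≡0 emb emb≡ =
  cong₂ _+_ (cong g (FinP.toℕ-injective (sym (emb≡ zero))))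
    (trans (∑-vanishing-suffix p≤n (λ l → g (suc l)) (λ l p≤l → suffix≡0 (suc l) (s≤s p≤l)) emb′ emb′≡)
           (∑-cong (λ i → cong g (FinP.toℕ-injective (trans (cong ℕ.suc (emb′≡ i)) (sym (emb≡ (suc i))))))))
  where
  emb′ = topIndex p≤n
  emb′≡ = toℕ-topIndex p≤n

BottomUnitriangular : ∀ {n} → ℕ → Matrix n → Set
BottomUnitriangular {n} k X =
  ∀ (i j : Fin n) → n ∸ k ≤ toℕ i → (toℕ j < toℕ i → X i j ≡ 0ℤ) × (toℕ j ≡ toℕ i → X i j ≡ 1ℤ)

BottomUnitriangular-mono : ∀ {n k m} {X : Matrix n} → k ≤ m → BottomUnitriangular m X → BottomUnitriangular k X
BottomUnitriangular-mono {n} k≤m X↓ i j n∸k≤i = X↓ i j (ℕP.≤-trans (ℕP.∸-monoʳ-≤ n k≤m) n∸k≤i)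

-- The bottom block of Y ⊗ B′ is a unitriangular matrix times the bottom block of B′.
bottomMinor-unitriangular-⊗ : ∀ {n k} (k≤n : k ≤ n) {B B′ Y : Matrix n} → BottomUnitriangular k Y →
  (∀ i → n ∸ k ≤ toℕ i → ∀ c → B i c ≡ (Y ⊗ B′) i c) →
  ∀ (c : Fin k → Fin n) → bottomMinor k≤n B c ≡ bottomMinor k≤n B′ c
bottomMinor-unitriangular-⊗ {n} {k} k≤n {B} {B′} {Y} Y↓ B≗Y⊗B′ c = begin
  bottomMinor k≤n B c   ≡⟨ det-cong B≋U⊗M′ ⟩
  det (U ⊗ M′)          ≡⟨ det-⊗ U M′ ⟩
  det U * det M′        ≡⟨ cong (_* det M′) (det-upperUnitriangular U U-unitriangular) ⟩
  1ℤ * det M′           ≡⟨ ℤP.*-identityˡ (det M′) ⟩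
  det M′                ∎
  where
  open ≡-Reasoning
  bR = bottomRow k≤n
  U : Matrix k
  U i i′ = Y (bR i) (bR i′)
  M′ : Matrix k
  M′ i s = B′ (bR i) (c s)
  U-unitriangular : UpperUnitriangular U
  U-unitriangular =
    (λ i i′ i′<i → proj₁ (Y↓ (bR i) (bR i′) (bottomRow-≥ k≤n i))
      (subst₂ _<_ (sym (toℕ-bottomRow k≤n i′)) (sym (toℕ-bottomRow k≤n i)) (ℕP.+-monoʳ-< (n ∸ k) i′<i))) ,
    (λ i → proj₂ (Y↓ (bR i) (bR i) (bottomRow-≥ k≤n i)) refl)
  B≋U⊗M′ : (λ i s → B (bR i) (c s)) ≋ U ⊗ M′
  B≋U⊗M′ i s = trans (B≗Y⊗B′ (bR i) (bottomRow-≥ k≤n i) (c s))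
    (∑-vanishing-prefix (n ∸ k) (ℕP.m∸n+n≡m k≤n) (λ l → Y (bR i) l * B′ l (c s))
      (λ l l<n∸k → trans (cong (_* B′ l (c s))
                            (proj₁ (Y↓ (bR i) l (bottomRow-≥ k≤n i)) (ℕP.<-≤-trans l<n∸k (bottomRow-≥ k≤n i))))
                         (ℤP.*-zeroˡ (B′ l (c s))))
      bR (toℕ-bottomRow k≤n))

bottomMinor-id : ∀ {n} (n≤n : n ≤ n) (M : Matrix n) → bottomMinor n≤n M (λ s → s) ≡ det M
bottomMinor-id {n} n≤n M = det-cong (λ i s → cong (λ r → M r s)
  (FinP.toℕ-injective (trans (toℕ-bottomRow n≤n i) (cong (ℕ._+ toℕ i) (ℕP.n∸n≡0 n)))))

minor-bottomMinor : ∀ {n k} (k≤n : k ≤ n) (M : Matrix (ℕ.suc n)) j (c : Fin k → Fin n) →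
  bottomMinor k≤n (minor M j) c ≡ bottomMinor (ℕP.m≤n⇒m≤1+n k≤n) M (λ s → punchIn j (c s))
minor-bottomMinor {n} {k} k≤n M j c = det-cong (λ i s → cong (λ r → M r (punchIn j (c s)))
  (FinP.toℕ-injective (trans (cong ℕ.suc (toℕ-bottomRow k≤n i))
    (sym (trans (toℕ-bottomRow (ℕP.m≤n⇒m≤1+n k≤n) i) (cong (ℕ._+ toℕ i) (ℕP.+-∸-assoc 1 k≤n)))))))

-- Laplace expansion along the top rows, down to the bottom k rows.
det-≡-from-bottomMinors : ∀ {n k} (k≤n : k ≤ n) (M M′ : Matrix n) →
  (∀ i → toℕ i < n ∸ k → ∀ c → M i c ≡ M′ i c) →
  (∀ c → StrictlyIncreasing c → bottomMinor k≤n M c ≡ bottomMinor k≤n M′ c) →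
  det M ≡ det M′
det-≡-from-bottomMinors {ℕ.zero}  k≤n M M′ _ _ = refl
det-≡-from-bottomMinors {ℕ.suc n} {k} k≤n M M′ top≗ bottom≡ = by-cases (k ℕ.≟ ℕ.suc n)
  (λ { refl → trans (sym (bottomMinor-id k≤n M))
                    (trans (bottom≡ (λ s → s) (λ _ _ a<b → a<b)) (bottomMinor-id k≤n M′)) })
  (λ k≢1+n → let k≤n′ = ℕ.s≤s⁻¹ (ℕP.≤∧≢⇒< k≤n k≢1+n)
                 1+n∸k≡ = ℕP.+-∸-assoc 1 k≤n′ in
    laplace-cong (top≗ zero (subst (0 <_) (sym 1+n∸k≡) (s≤s z≤n)))
      (λ j → det-≡-from-bottomMinors k≤n′ (minor M j) (minor M′ j)
        (λ r r< c → top≗ (suc r) (subst (ℕ.suc (toℕ r) <_) (sym 1+n∸k≡) (s≤s r<)) (punchIn j c))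
        (λ c c↑ → trans (minor-bottomMinor k≤n′ M j c)
                    (trans (bottom≡ _ (punchIn-strictlyIncreasing j c↑)) (sym (minor-bottomMinor k≤n′ M′ j c))))))

det-identityBelow : ∀ {n p} (p≤n : p ≤ n) (M : Matrix n) → (∀ i c → p ≤ toℕ i → M i c ≡ δ i c) →
  det M ≡ det (λ r s → M (topIndex p≤n r) (topIndex p≤n s))
det-identityBelow {n} {ℕ.zero} p≤n M M≗I = trans (det-cong (λ i c → M≗I i c z≤n)) (det-I {n})
det-identityBelow {ℕ.suc n} {ℕ.suc p} (s≤s p≤n) M M≗I = begin
  det M
    ≡⟨ ∑-vanishing-suffix (s≤s p≤n) term term-vanishes tI (toℕ-topIndex (s≤s p≤n)) ⟩
  ∑ (λ j → term (tI j))
    ≡⟨ ∑-cong (λ j → cong₂ (λ x y → sgn x * (M zero (tI j) * y)) (toℕ-topIndex (s≤s p≤n) j) (minor-top j)) ⟩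
  det (λ r s → M (tI r) (tI s)) ∎
  where
  open ≡-Reasoning
  tI = topIndex (s≤s p≤n)
  term : Fin (ℕ.suc n) → ℤ
  term j = sgn (toℕ j) * (M zero j * det (minor M j))
  term-vanishes : ∀ l → ℕ.suc p ≤ toℕ l → term l ≡ 0ℤ
  term-vanishes (suc r) (s≤s p≤r) =
    trans (cong (λ x → sgn (toℕ (suc r)) * (M zero (suc r) * x))
            (det-zeroRow (minor M (suc r)) r (λ c → trans (M≗I (suc r) (punchIn (suc r) c) (s≤s p≤r))
                                                          (δ-≢ (λ p → FinP.punchInᵢ≢i (suc r) c (sym p))))))
          (trans (cong (sgn (toℕ (suc r)) *_) (ℤP.*-zeroʳ (M zero (suc r)))) (ℤP.*-zeroʳ (sgn (toℕ (suc r)))))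
  minor-top : ∀ j → det (minor M (tI j)) ≡ det (minor (λ r s → M (tI r) (tI s)) j)
  minor-top j = trans
    (det-identityBelow p≤n (minor M (tI j))
      (λ r c p≤r → trans (M≗I (suc r) (punchIn (tI j) c) (s≤s p≤r))
        (δ-shift (tI j) r c (subst (_≤ toℕ r) (sym (toℕ-topIndex (s≤s p≤n) j)) (ℕP.≤-trans (ℕ.s≤s⁻¹ (FinP.toℕ<n j)) p≤r)))))
    (det-cong (λ r s → cong₂ M
      (FinP.toℕ-injective (trans (cong ℕ.suc (toℕ-topIndex p≤n r)) (sym (toℕ-topIndex (s≤s p≤n) (suc r)))))
      (FinP.toℕ-injective (trans (toℕ-punchIn-cong (toℕ-topIndex (s≤s p≤n) j) (toℕ-topIndex p≤n s))
                                 (sym (toℕ-topIndex (s≤s p≤n) (punchIn j s)))))))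

∸-suc : ∀ n k → ℕ.suc k ≤ n → n ∸ k ≡ ℕ.suc (n ∸ ℕ.suc k)
∸-suc (ℕ.suc n) ℕ.zero    _         = refl
∸-suc (ℕ.suc n) (ℕ.suc k) (s≤s k<n) = ∸-suc n k k<n

EqualBottomMinors : ∀ {n} → ℕ → Matrix n → Matrix n → Set
EqualBottomMinors {n} m A A′ = ∀ (k : ℕ) (1≤k : 1 ≤ k) (k≤m : k ≤ m) (k≤n : k ≤ n) (c : Fin k → Fin n) →
  StrictlyIncreasing c → bottomMinor k≤n A c ≡ bottomMinor k≤n A′ c

-- X is forced to be A A′⁻¹, whose entries are given by Cramer's rule. Its bottom rows are shown
-- unitriangular from the bottom up, comparing A′ with the matrix B′ obtained by replacing row r by A r.
module Sufficiency {n m : ℕ} (m<n : m < n) (A A′ : Matrix n) (detA≡1 : det A ≡ 1ℤ) (detA′≡1 : det A′ ≡ 1ℤ)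
                   (minors≡ : EqualBottomMinors m A A′) where

  X : Matrix n
  X r l = det (setRow A′ l (A r))

  A≋X⊗A′ : ∀ r c → A r c ≡ (X ⊗ A′) r c
  A≋X⊗A′ r c = sym (trans (cramer A′ (A r) c) (trans (cong (_* A r c) detA′≡1) (ℤP.*-identityˡ (A r c))))

  module Row (k : ℕ) (1+k≤m : ℕ.suc k ≤ m) (X↓ : BottomUnitriangular k X) (r : Fin n) (r≡ : toℕ r ≡ n ∸ ℕ.suc k) where

    K = ℕ.suc k
    K≤n : K ≤ n
    K≤n = ℕP.≤-trans 1+k≤m (<⇒≤ m<n)

    strictlyBelow-r : ∀ i → n ∸ K ≤ toℕ i → i ≢ r → n ∸ k ≤ toℕ i
    strictlyBelow-r i n∸K≤i i≢r = subst (_≤ toℕ i) (sym (∸-suc n k K≤n))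
      (ℕP.≤∧≢⇒< n∸K≤i (λ p → i≢r (FinP.toℕ-injective (trans (sym p) (sym r≡)))))

    top≢r : ∀ i → toℕ i < n ∸ K → i ≢ r
    top≢r i i<n∸K i≡r = ℕP.<-irrefl (trans (cong toℕ i≡r) r≡) i<n∸K

    B′ = setRow A′ r (A r)
    Y = setRow X r (δ r)

    X-below-r : ∀ i → n ∸ K ≤ toℕ i → i ≢ r → X i r ≡ 0ℤ
    X-below-r i n∸K≤i i≢r = proj₁ (X↓ i r (strictlyBelow-r i n∸K≤i i≢r))
      (subst (_< toℕ i) (sym r≡) (subst (_≤ toℕ i) (∸-suc n k K≤n) (strictlyBelow-r i n∸K≤i i≢r)))

    Y↓ : BottomUnitriangular K Y
    Y↓ i j n∸K≤i = by-cases (i ≟ r)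
      (λ i≡r → (λ j<i → trans (setRow-≡ X r (δ r) i≡r j) (δ-≢ (λ r≡j → ℕP.<-irrefl (cong toℕ (trans (sym r≡j) (sym i≡r))) j<i)))
             , (λ j≡i → trans (setRow-≡ X r (δ r) i≡r j) (δ-≡ (trans (sym i≡r) (FinP.toℕ-injective (sym j≡i))))))
      (λ i≢r → let (left≡0 , diag≡1) = X↓ i j (strictlyBelow-r i n∸K≤i i≢r) in
               (λ j<i → trans (setRow-≢ X r (δ r) i≢r j) (left≡0 j<i))
             , (λ j≡i → trans (setRow-≢ X r (δ r) i≢r j) (diag≡1 j≡i)))

    -- Below row r, column r of X vanishes, so the bottom K rows of A are those of Y ⊗ B′.
    A≋Y⊗B′ : ∀ i → n ∸ K ≤ toℕ i → ∀ c → A i c ≡ (Y ⊗ B′) i c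
    A≋Y⊗B′ i n∸K≤i c = by-cases (i ≟ r)
      (λ i≡r → trans (cong (λ x → A x c) i≡r) (trans (sym (setRow-≡ A′ r (A r) refl c))
        (trans (sym (∑-δ-* (λ l → B′ l c) r)) (∑-cong (λ l → cong (_* B′ l c) (sym (setRow-≡ X r (δ r) i≡r l)))))))
      (λ i≢r → trans (A≋X⊗A′ i c) (∑-cong (λ l → trans (by-cases (l ≟ r)
          (λ { refl → trans (cong (_* A′ l c) (X-below-r i n∸K≤i i≢r))
                            (sym (cong (_* B′ l c) (X-below-r i n∸K≤i i≢r))) })
          (λ l≢r → cong (X i l *_) (sym (setRow-≢ A′ r (A r) l≢r c))))
        (cong (_* B′ l c) (sym (setRow-≢ X r (δ r) i≢r l))))))

    B′-minors≡ : ∀ c → StrictlyIncreasing c → bottomMinor K≤n B′ c ≡ bottomMinor K≤n A′ c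
    B′-minors≡ c c↑ = trans (sym (bottomMinor-unitriangular-⊗ K≤n Y↓ A≋Y⊗B′ c)) (minors≡ K (s≤s z≤n) 1+k≤m K≤n c c↑)

    X-diag : X r r ≡ 1ℤ
    X-diag = trans (det-≡-from-bottomMinors K≤n B′ A′ (λ i i< → setRow-≢ A′ r (A r) (top≢r i i<)) B′-minors≡) detA′≡1

    -- Swapping rows l and r of A′ with row l replaced by A r gives a matrix with the top rows
    -- of A′ with row l replaced by A′ r (determinant 0) and the bottom minors of B′.
    X-left : ∀ l → toℕ l < toℕ r → X r l ≡ 0ℤ
    X-left l l<r = begin
      X r l          ≡⟨ sym (ℤP.neg-involutive (X r l)) ⟩
      - - X r l      ≡⟨ cong -_ (sym (swapRows-antisym Q l≢r)) ⟩
      - det Q′       ≡⟨ cong -_ (det-≡-from-bottomMinors K≤n Q′ Q″ Q′-top Q′-minors) ⟩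
      - det Q″       ≡⟨ cong -_ (setRow-copy A′ (λ r≡l → l≢r (sym r≡l))) ⟩
      - 0ℤ           ∎
      where
      open ≡-Reasoning
      open AlternatingMultilinear (det-isAlternatingMultilinear {n})
      l≢r : l ≢ r
      l≢r l≡r = ℕP.<-irrefl (cong toℕ l≡r) l<r
      r≢l = λ r≡l → l≢r (sym r≡l)
      Q = setRow A′ l (A r)
      Q′ = swapRows Q l r
      Q″ = setRow A′ l (A′ r)
      Q′-r : ∀ c → Q′ r c ≡ A r c
      Q′-r c = trans (setRow-≡ (setRow Q l (Q r)) r (Q l) refl c) (setRow-≡ A′ l (A r) refl c)
      Q′-other : ∀ i → i ≢ r → i ≢ l → ∀ c → Q′ i c ≡ A′ i c
      Q′-other i i≢r i≢l c = trans (setRow-≢ (setRow Q l (Q r)) r (Q l) i≢r c)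
        (trans (setRow-≢ Q l (Q r) i≢l c) (setRow-≢ A′ l (A r) i≢l c))
      Q′-top : ∀ i → toℕ i < n ∸ K → ∀ c → Q′ i c ≡ Q″ i c
      Q′-top i i<n∸K c = by-cases (i ≟ l)
        (λ i≡l → trans (setRow-≢ (setRow Q l (Q r)) r (Q l) (top≢r i i<n∸K) c)
          (trans (setRow-≡ Q l (Q r) i≡l c) (trans (setRow-≢ A′ l (A r) r≢l c) (sym (setRow-≡ A′ l (A′ r) i≡l c)))))
        (λ i≢l → trans (Q′-other i (top≢r i i<n∸K) i≢l c) (sym (setRow-≢ A′ l (A′ r) i≢l c)))
      bottom≢l : ∀ i → bottomRow K≤n i ≢ l
      bottom≢l i bRᵢ≡l = ℕP.<-irrefl refl (ℕP.<-≤-trans (subst (_< toℕ r) (cong toℕ (sym bRᵢ≡l)) l<r)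
        (subst (_≤ toℕ (bottomRow K≤n i)) (sym r≡) (bottomRow-≥ K≤n i)))
      Q′-minors : ∀ c → StrictlyIncreasing c → bottomMinor K≤n Q′ c ≡ bottomMinor K≤n Q″ c
      Q′-minors c c↑ = trans
        (det-cong (λ i s → by-cases (bottomRow K≤n i ≟ r)
          (λ bRᵢ≡r → trans (cong (λ x → Q′ x (c s)) bRᵢ≡r) (trans (Q′-r (c s)) (sym (setRow-≡ A′ r (A r) bRᵢ≡r (c s)))))
          (λ bRᵢ≢r → trans (Q′-other _ bRᵢ≢r (bottom≢l i) (c s)) (sym (setRow-≢ A′ r (A r) bRᵢ≢r (c s))))))
        (trans (B′-minors≡ c c↑) (det-cong (λ i s → sym (setRow-≢ A′ l (A′ r) (bottom≢l i) (c s)))))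

  X↓ : ∀ k → k ≤ m → BottomUnitriangular k X
  X↓ ℕ.zero    _     i _ n≤i = ⊥-elim (ℕP.<-irrefl refl (ℕP.<-≤-trans (FinP.toℕ<n i) n≤i))
  X↓ (ℕ.suc k) 1+k≤m i j n∸K≤i = by-cases (n ∸ k ℕ.≤? toℕ i)
    (λ n∸k≤i → X↓ k (ℕP.≤-trans (ℕP.n≤1+n k) 1+k≤m) i j n∸k≤i)
    (λ n∸k≰i → let i≡ = ℕP.≤-antisym (ℕ.s≤s⁻¹ (subst (toℕ i <_) (∸-suc n k K≤n) (ℕP.≰⇒> n∸k≰i))) n∸K≤i
                   open Row k 1+k≤m (X↓ k (ℕP.≤-trans (ℕP.n≤1+n k) 1+k≤m)) i i≡ in
               X-left j , (λ j≡i → trans (cong (X i) (FinP.toℕ-injective j≡i)) X-diag))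
    where
    K≤n = ℕP.≤-trans 1+k≤m (<⇒≤ m<n)

  det-X : det X ≡ 1ℤ
  det-X = begin
    det X                 ≡⟨ sym (ℤP.*-identityʳ (det X)) ⟩
    det X * 1ℤ            ≡⟨ cong (det X *_) (sym detA′≡1) ⟩
    det X * det A′        ≡⟨ sym (det-⊗ X A′) ⟩
    det (X ⊗ A′)          ≡⟨ sym (det-cong A≋X⊗A′) ⟩
    det A                 ≡⟨ detA≡1 ⟩
    1ℤ                    ∎
    where open ≡-Reasoning

  m≤n = <⇒≤ m<n
  p = n ∸ m
  p≤n = ℕP.m∸n≤m n m

  X-bottom-to-I : Matrix n
  X-bottom-to-I i c with p ℕ.≤? toℕ i
  ... | yes _ = δ i c
  ... | no  _ = X i c

  bottom-to-I : ∀ i c → p ≤ toℕ i → X-bottom-to-I i c ≡ δ i c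
  bottom-to-I i c p≤i with p ℕ.≤? toℕ i
  ... | yes _   = refl
  ... | no  p≰i = ⊥-elim (p≰i p≤i)

  top-unchanged : ∀ i c → toℕ i < p → X-bottom-to-I i c ≡ X i c
  top-unchanged i c i<p with p ℕ.≤? toℕ i
  ... | yes p≤i = ⊥-elim (ℕP.<⇒≱ i<p p≤i)
  ... | no  _   = refl

  -- X is unitriangular below, so X = X ⊗ (X with its bottom rows replaced by those of I).
  det-X≡det-top : det X ≡ det (λ r s → X (topIndex p≤n r) (topIndex p≤n s))
  det-X≡det-top = begin
    det X
      ≡⟨ det-≡-from-bottomMinors m≤n X X-bottom-to-I (λ i i<p c → sym (top-unchanged i c i<p))
           (λ c _ → bottomMinor-unitriangular-⊗ m≤n (X↓ m ℕP.≤-refl) X≋X⊗X′ c) ⟩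
    det X-bottom-to-I
      ≡⟨ det-identityBelow p≤n X-bottom-to-I bottom-to-I ⟩
    det (λ r s → X-bottom-to-I (topIndex p≤n r) (topIndex p≤n s))
      ≡⟨ det-cong (λ r s → top-unchanged _ _ (subst (_< p) (sym (toℕ-topIndex p≤n r)) (FinP.toℕ<n r))) ⟩
    det (λ r s → X (topIndex p≤n r) (topIndex p≤n s)) ∎
    where
    open ≡-Reasoning
    X≋X⊗X′ : ∀ i → p ≤ toℕ i → ∀ c → X i c ≡ (X ⊗ X-bottom-to-I) i c
    X≋X⊗X′ i p≤i c = trans (sym (∑-*-δ (X i) c)) (∑-cong (λ l → by-cases (p ℕ.≤? toℕ l)
      (λ p≤l → cong (X i l *_) (sym (bottom-to-I l c p≤l)))
      (λ p≰l → let X-il≡0 = proj₁ (X↓ m ℕP.≤-refl i l p≤i) (ℕP.<-≤-trans (ℕP.≰⇒> p≰l) p≤i) in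
               trans (cong (_* δ l c) X-il≡0) (sym (cong (_* X-bottom-to-I l c) X-il≡0)))))

  X∈P̃ : InPtilde n m m≤n X
  X∈P̃ = trans (sym det-X≡det-top) det-X , X↓ m ℕP.≤-refl

proposition9p2 : (n m : ℕ) → 2 ≤ n → 1 ≤ m → (m<n : m < n) →
    (A A' : Matrix n) → IsSL A → IsSL A' →
    (Σ (Matrix n) (λ X → InPtilde n m (<⇒≤ m<n) X × (∀ i j → A i j ≡ (X ⊗ A') i j)))
    ⇔ (∀ (k : ℕ) (1≤k : 1 ≤ k) (k≤m : k ≤ m) (k≤n : k ≤ n) (c : Fin k → Fin n) →
         StrictlyIncreasing c → bottomMinor k≤n A c ≡ bottomMinor k≤n A' c)
proposition9p2 n m _ _ m<n A A′ detA≡1 detA′≡1 = mk⇔ necessary sufficient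
  where
  necessary : Σ (Matrix n) (λ X → InPtilde n m (<⇒≤ m<n) X × (∀ i j → A i j ≡ (X ⊗ A′) i j)) → EqualBottomMinors m A A′
  necessary (X , (_ , X↓) , A≋X⊗A′) k _ k≤m k≤n c _ =
    bottomMinor-unitriangular-⊗ k≤n (BottomUnitriangular-mono k≤m X↓) (λ i _ → A≋X⊗A′ i) c
  sufficient : EqualBottomMinors m A A′ → Σ (Matrix n) (λ X → InPtilde n m (<⇒≤ m<n) X × (∀ i j → A i j ≡ (X ⊗ A′) i j))
  sufficient minors≡ = X , X∈P̃ , A≋X⊗A′
    where open Sufficiency m<n A A′ detA≡1 detA′≡1 minors≡
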